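{- Let $M$ and $N$ be matroids on disjoint finite sets $S$ and $T$, and let $A\subseteq S$, $B\subseteq T$ be such that $A$ is a cyclic flat of $M$ and $B$ is a cyclic flat of the dual $N^*$. Then the cyclic flats of $(M,N;A,B)$ are exactly the sets $Z_M\cup Z_N$ where $Z_M$ is a cyclic flat of $M$, $Z_N$ is a cyclic flat of $N$, and either $A\subseteq Z_M$ or $Z_N\cap B=\emptyset$.
   Context: A set in a matroid is cyclic if it is a (possibly empty) union of circuits; a cyclic flat is a flat that is cyclic. The principal sum $(M,N;A,B)$ is the matroid union $M^+(A,B)\vee N_0$, where: $N_0=N\oplus U_{0,S}$ ($N$ with the elements of $S$ added as loops); $M^+(A,B)$ is the matroid on $S\cup T$ obtained from $M$ by adding each element of $B$ freely (by successive principal extensions) to the flat $\mathrm{cl}_M(A)$ and each element of $T-B$ as a loop, equivalently the matroid with rank function $r(X\cup Y)=\min\{r_M(X\cup A),\,r_M(X)+|Y\cap B|\}$ for $X\subseteq S$, $Y\subseteq T$; and the matroid union $G\vee H$ of matroids on a common set has as independent sets the unions of an independent set of $G$ and an independent set of $H$. -}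

module Defs where

open import Data.Nat using (ℕ; _+_; _∸_; _≤_; _⊓_)
open import Data.Fin using (Fin)
open import Data.Fin.Subset
  using (Subset; _∈_; _∉_; _⊆_; _⊂_; _∪_; _∩_; ∁; ∣_∣; ⁅_⁆; ⊤)
open import Data.Vec using (Vec; take; drop; _++_)
open import Data.Product using (Σ; ∃; ∃-syntax; _×_; _,_)
open import Data.Empty renaming (⊥ to Empty)
open import Relation.Binary.PropositionalEquality using (_≡_)
open import Relation.Nullary using (¬_)

record Matroid (n : ℕ) : Set where
  field
    r        : Subset n → ℕ
    r-bound  : ∀ X → r X ≤ ∣ X ∣
    r-mono   : ∀ X Y → X ⊆ Y → r X ≤ r Y
    r-submod : ∀ X Y → r (X ∪ Y) + r (X ∩ Y) ≤ r X + r Y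
open Matroid public

dualRank : ∀ {n} → Matroid n → Subset n → ℕ
dualRank M X = ∣ X ∣ + r M (∁ X) ∸ r M ⊤

IndR : ∀ {n} → (Subset n → ℕ) → Subset n → Set
IndR ρ I = ρ I ≡ ∣ I ∣

module _ {n : ℕ} (Ind : Subset n → Set) where

  Circuit : Subset n → Set
  Circuit C = ¬ Ind C × (∀ D → D ⊂ C → Ind D)

  Cyclic : Subset n → Set
  Cyclic X = ∀ x → x ∈ X → ∃[ C ] (Circuit C × C ⊆ X × x ∈ C)

  HasRank : Subset n → ℕ → Set
  HasRank X k = (∃[ I ] (I ⊆ X × Ind I × ∣ I ∣ ≡ k))
              × (∀ I → I ⊆ X → Ind I → ∣ I ∣ ≤ k)

  Flat : Subset n → Set
  Flat X = ∀ e → e ∉ X → ∀ k → HasRank X k → HasRank (X ∪ ⁅ e ⁆) k → Empty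

  CyclicFlat : Subset n → Set
  CyclicFlat X = Cyclic X × Flat X

-- Principal sum (M,N;A,B) on S ∪ T, with S = Fin s, T = Fin t, and
-- S ∪ T encoded as Fin (s + t) (a subset X ∪ Y is X ++ Y).

plusRank : ∀ {s t} → Matroid s → Subset s → Subset t → Subset (s + t) → ℕ
plusRank {s} M A B Z = r M (take s Z ∪ A) ⊓ (r M (take s Z) + ∣ drop s Z ∩ B ∣)

-- Rank of N₀ = N ⊕ U_{0,S}: r(X ∪ Y) = rN(Y).
loopRank : ∀ {s t} → Matroid t → Subset (s + t) → ℕ
loopRank {s} N Z = r N (drop s Z)

UnionInd : ∀ {n} → (Subset n → Set) → (Subset n → Set) → Subset n → Set
UnionInd I₁ I₂ I = ∃[ J₁ ] ∃[ J₂ ] (I ≡ J₁ ∪ J₂ × I₁ J₁ × I₂ J₂)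

PrincipalSumInd : ∀ {s t} → Matroid s → Matroid t → Subset s → Subset t
                → Subset (s + t) → Set
PrincipalSumInd {s} {t} M N A B =
  UnionInd (IndR (plusRank M A B)) (IndR (loopRank {s} N))

module Submission where

-- First, the principal sum
-- is identified with the matroid on S ⊎ T whose rank at X ∪ Y is
--   σ X Y = min { rM (X ∪ A) + rN Y ,  rM X + rN (Y ∖ B) + ∣Y ∩ B∣ } :
-- σ satisfies the rank axioms (the minimum of two submodular functions linked
-- by a mixed submodular inequality) and has the independent sets of
-- M⁺(A,B) ∨ N₀.  Next, cyclic flats are characterised by ranks: X is a cyclic
-- flat iff deleting an element of X never lowers the rank and adding an
-- element outside X always raises it.  For σ these conditions split into
-- conditions on the components X and Y.  Finally, σ ≥ rM + rN with equality
-- when A ⊆ X or Y ∩ B = ∅; a cyclic flat of σ must satisfy this side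
-- condition, and then its components are cyclic flats of M and N, and
-- conversely.  The hypotheses enter only at two boundary cases: A cyclic in M,
-- and ∁ B a flat of N (which is what B cyclic in N* gives).

open import Defs
open import Data.Nat using (ℕ; zero; suc; _+_; _∸_; _≤_; _<_; _⊓_; z≤n)
open import Data.Nat.Properties
open import Data.Nat.Induction using (<-wellFounded)
open import Data.Bool using (_∨_; _∧_)
open import Data.Fin using (Fin; zero; suc; _↑ˡ_; _↑ʳ_)
open import Data.Fin.Properties using (any?) renaming (_≟_ to _≟ᶠ_)
open import Data.Fin.Subset
open import Data.Fin.Subset.Properties
open import Data.Vec using ([]; _∷_; _++_; take; drop; here; there)
open import Data.Vec.Properties
  using (take++drop≡id; zipWith-++; lookup-++ˡ; lookup-++ʳ; []=⇒lookup; lookup⇒[]=)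
open import Data.Product using (∃; ∃-syntax; _×_; _,_; proj₁; proj₂)
open import Data.Product.Function.NonDependent.Propositional using (_×-⇔_)
open import Data.Sum using (_⊎_; inj₁; inj₂; [_,_]′)
open import Data.Empty using (⊥-elim)
open import Algebra.Properties.CommutativeSemigroup +-commutativeSemigroup using (interchange)
open import Function using (_∘_; id)
open import Function.Bundles using (_⇔_; mk⇔; Equivalence)
open import Function.Construct.Identity using (⇔-id)
open import Function.Construct.Symmetry using (⇔-sym)
open import Function.Properties.Equivalence using (⇔-setoid)
open import Induction.WellFounded using (module All)
open import Level using (0ℓ)
import Relation.Binary.Construct.On as On
import Relation.Binary.Reasoning.Setoid as SetoidReasoning
open import Relation.Binary.PropositionalEquality
open import Relation.Nullary using (¬_; yes; no)
open import Relation.Nullary.Decidable using (decidable-stable; _×-dec_; ¬?)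

∪-mono : ∀ {n} {P P′ Q Q′ : Subset n} → P ⊆ P′ → Q ⊆ Q′ → P ∪ Q ⊆ P′ ∪ Q′
∪-mono {P = P} {P′} {Q} {Q′} P⊆P′ Q⊆Q′ x∈P∪Q with x∈p∪q⁻ P Q x∈P∪Q
... | inj₁ x∈P = p⊆p∪q Q′ (P⊆P′ x∈P)
... | inj₂ x∈Q = q⊆p∪q P′ Q′ (Q⊆Q′ x∈Q)

∩-mono : ∀ {n} {P P′ Q Q′ : Subset n} → P ⊆ P′ → Q ⊆ Q′ → P ∩ Q ⊆ P′ ∩ Q′
∩-mono {P = P} {Q = Q} P⊆P′ Q⊆Q′ x∈P∩Q =
  let x∈P , x∈Q = x∈p∩q⁻ P Q x∈P∩Q in x∈p∩q⁺ (P⊆P′ x∈P , Q⊆Q′ x∈Q)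

∣p∩q∣+∣p∩∁q∣≡∣p∣ : ∀ {n} (p q : Subset n) → ∣ p ∩ q ∣ + ∣ p ∩ ∁ q ∣ ≡ ∣ p ∣
∣p∩q∣+∣p∩∁q∣≡∣p∣ []            []            = refl
∣p∩q∣+∣p∩∁q∣≡∣p∣ (inside  ∷ p) (inside  ∷ q) = cong suc (∣p∩q∣+∣p∩∁q∣≡∣p∣ p q)
∣p∩q∣+∣p∩∁q∣≡∣p∣ (inside  ∷ p) (outside ∷ q) = trans (+-suc _ _) (cong suc (∣p∩q∣+∣p∩∁q∣≡∣p∣ p q))
∣p∩q∣+∣p∩∁q∣≡∣p∣ (outside ∷ p) (inside  ∷ q) = ∣p∩q∣+∣p∩∁q∣≡∣p∣ p q
∣p∩q∣+∣p∩∁q∣≡∣p∣ (outside ∷ p) (outside ∷ q) = ∣p∩q∣+∣p∩∁q∣≡∣p∣ p q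

∣p∪q∣+∣p∩q∣≡∣p∣+∣q∣ : ∀ {n} (p q : Subset n) → ∣ p ∪ q ∣ + ∣ p ∩ q ∣ ≡ ∣ p ∣ + ∣ q ∣
∣p∪q∣+∣p∩q∣≡∣p∣+∣q∣ []            []            = refl
∣p∪q∣+∣p∩q∣≡∣p∣+∣q∣ (inside  ∷ p) (inside  ∷ q) =
  cong suc (trans (+-suc _ _) (trans (cong suc (∣p∪q∣+∣p∩q∣≡∣p∣+∣q∣ p q)) (sym (+-suc _ _))))
∣p∪q∣+∣p∩q∣≡∣p∣+∣q∣ (inside  ∷ p) (outside ∷ q) = cong suc (∣p∪q∣+∣p∩q∣≡∣p∣+∣q∣ p q)
∣p∪q∣+∣p∩q∣≡∣p∣+∣q∣ (outside ∷ p) (inside  ∷ q) =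
  trans (cong suc (∣p∪q∣+∣p∩q∣≡∣p∣+∣q∣ p q)) (sym (+-suc _ _))
∣p∪q∣+∣p∩q∣≡∣p∣+∣q∣ (outside ∷ p) (outside ∷ q) = ∣p∪q∣+∣p∩q∣≡∣p∣+∣q∣ p q

∣p∪q∣≤∣p∣+∣q∣ : ∀ {n} (p q : Subset n) → ∣ p ∪ q ∣ ≤ ∣ p ∣ + ∣ q ∣
∣p∪q∣≤∣p∣+∣q∣ p q = subst (∣ p ∪ q ∣ ≤_) (∣p∪q∣+∣p∩q∣≡∣p∣+∣q∣ p q) (m≤m+n _ _)

∣p∪⁅x⁆∣≡1+∣p∣ : ∀ {n} (p : Subset n) (x : Fin n) → x ∉ p → ∣ p ∪ ⁅ x ⁆ ∣ ≡ suc ∣ p ∣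
∣p∪⁅x⁆∣≡1+∣p∣ (inside  ∷ p) zero    x∉p = ⊥-elim (x∉p here)
∣p∪⁅x⁆∣≡1+∣p∣ (outside ∷ p) zero    x∉p = cong (λ q → suc ∣ q ∣) (∪-identityʳ p)
∣p∪⁅x⁆∣≡1+∣p∣ (inside  ∷ p) (suc x) x∉p = cong suc (∣p∪⁅x⁆∣≡1+∣p∣ p x (x∉p ∘ there))
∣p∪⁅x⁆∣≡1+∣p∣ (outside ∷ p) (suc x) x∉p = ∣p∪⁅x⁆∣≡1+∣p∣ p x (x∉p ∘ there)

∣p∣≡1+∣p-x∣ : ∀ {n} (p : Subset n) (x : Fin n) → x ∈ p → ∣ p ∣ ≡ suc ∣ p - x ∣
∣p∣≡1+∣p-x∣ (inside ∷ p) zero    _           = cong (λ q → suc ∣ q ∣) (sym (p─⊥≡p p))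
∣p∣≡1+∣p-x∣ (inside ∷ p) (suc x) (there x∈p) = cong suc (∣p∣≡1+∣p-x∣ p x x∈p)
∣p∣≡1+∣p-x∣ (outside ∷ p) (suc x) (there x∈p) = ∣p∣≡1+∣p-x∣ p x x∈p

p∪⁅x⁆≡p : ∀ {n} (p : Subset n) (x : Fin n) → x ∈ p → p ∪ ⁅ x ⁆ ≡ p
p∪⁅x⁆≡p (inside  ∷ p) zero    _           = cong (inside ∷_) (∪-identityʳ p)
p∪⁅x⁆≡p (inside  ∷ p) (suc x) (there x∈p) = cong (inside ∷_) (p∪⁅x⁆≡p p x x∈p)
p∪⁅x⁆≡p (outside ∷ p) (suc x) (there x∈p) = cong (outside ∷_) (p∪⁅x⁆≡p p x x∈p)

∣p∣≡0⇒x∉p : ∀ {n} (p : Subset n) → ∣ p ∣ ≡ 0 → ∀ {x} → x ∉ p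
∣p∣≡0⇒x∉p p ∣p∣≡0 {x} x∈p = 1+n≢0 (trans (sym (∣p∣≡1+∣p-x∣ p x x∈p)) ∣p∣≡0)

∣p∩q∣≡∣p∣⇒p⊆q : ∀ {n} (p q : Subset n) → ∣ p ∩ q ∣ ≡ ∣ p ∣ → p ⊆ q
∣p∩q∣≡∣p∣⇒p⊆q p q ∣p∩q∣≡∣p∣ {x} x∈p = decidable-stable (x ∈? q) λ x∉q →
  ∣p∣≡0⇒x∉p (p ∩ ∁ q) ∣p∩∁q∣≡0 (x∈p∩q⁺ (x∈p , x∉p⇒x∈∁p x∉q))
  where
  ∣p∩∁q∣≡0 : ∣ p ∩ ∁ q ∣ ≡ 0
  ∣p∩∁q∣≡0 = +-cancelˡ-≡ ∣ p ∩ q ∣ _ _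
    (trans (∣p∩q∣+∣p∩∁q∣≡∣p∣ p q) (trans (sym ∣p∩q∣≡∣p∣) (sym (+-identityʳ _))))

p∩q≡⊥⇒p⊆∁q : ∀ {n} {p q : Subset n} → p ∩ q ≡ ⊥ → p ⊆ ∁ q
p∩q≡⊥⇒p⊆∁q p∩q≡⊥ x∈p = x∉p⇒x∈∁p λ x∈q → ∉⊥ (subst (_ ∈_) p∩q≡⊥ (x∈p∩q⁺ (x∈p , x∈q)))

x∈p-y⁻ : ∀ {n} {p : Subset n} {x y : Fin n} → x ∈ p - y → x ∈ p × x ≢ y
x∈p-y⁻ {p = p} {x} {y} x∈p-y = p─q⊆p p ⁅ y ⁆ x∈p-y , λ { refl → y∉p-y p y x∈p-y }
  where
  y∉p-y : ∀ {n} (p : Subset n) y → y ∉ p - y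
  y∉p-y (_ ∷ p) zero    ()
  y∉p-y (_ ∷ p) (suc y) (there y∈p-y) = y∉p-y p y y∈p-y

∪-⊆ : ∀ {n} {P Q R : Subset n} → P ⊆ R → Q ⊆ R → P ∪ Q ⊆ R
∪-⊆ {P = P} {Q} P⊆R Q⊆R x∈P∪Q = [ P⊆R , Q⊆R ]′ (x∈p∪q⁻ P Q x∈P∪Q)

⁅x⁆⊆p : ∀ {n} {p : Subset n} {x : Fin n} → x ∈ p → ⁅ x ⁆ ⊆ p
⁅x⁆⊆p {p = p} {x} x∈p y∈⁅x⁆ = subst (_∈ p) (sym (x∈⁅y⁆⇒x≡y x y∈⁅x⁆)) x∈p

p⊆q⇒p-x⊆q-x : ∀ {n} {p q : Subset n} {x : Fin n} → p ⊆ q → p - x ⊆ q - x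
p⊆q⇒p-x⊆q-x p⊆q y∈p-x = let y∈p , y≢x = x∈p-y⁻ y∈p-x in x∈p∧x≢y⇒x∈p-y (p⊆q y∈p) y≢x

p-x∪⁅x⁆≡p : ∀ {n} (p : Subset n) {x : Fin n} → x ∈ p → (p - x) ∪ ⁅ x ⁆ ≡ p
p-x∪⁅x⁆≡p p {x} x∈p = ⊆-antisym (∪-⊆ (p─q⊆p p ⁅ x ⁆) (⁅x⁆⊆p x∈p)) p⊆
  where
  p⊆ : p ⊆ (p - x) ∪ ⁅ x ⁆
  p⊆ {y} y∈p with y ≟ᶠ x
  ... | yes refl = q⊆p∪q (p - y) ⁅ y ⁆ (x∈⁅x⁆ y)
  ... | no  y≢x  = p⊆p∪q ⁅ x ⁆ (x∈p∧x≢y⇒x∈p-y y∈p y≢x)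

card-ind : ∀ {n ℓ} (P : Subset n → Set ℓ)
         → (∀ X → (∀ Y → ∣ Y ∣ < ∣ X ∣ → P Y) → P X) → ∀ X → P X
card-ind P step =
  All.wfRec (On.wellFounded ∣_∣ <-wellFounded) _ P (λ X ih → step X (λ Y → ih {Y}))

subset-ind : ∀ {n ℓ} (P : Subset n → Set ℓ)
           → P ⊥ → (∀ X x → P X → P (X ∪ ⁅ x ⁆)) → ∀ X → P X
subset-ind P base step = card-ind P go
  where
  go : ∀ X → (∀ Y → ∣ Y ∣ < ∣ X ∣ → P Y) → P X
  go X ih with nonempty? X
  ... | no  X-empty    = subst P (sym (Empty-unique X-empty)) base
  ... | yes (x , x∈X) =
    subst P (p-x∪⁅x⁆≡p X x∈X) (step (X - x) x (ih (X - x) (x∈p⇒∣p-x∣<∣p∣ x∈X)))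

⊈⇒∃∉ : ∀ {n} {P Q : Subset n} → ¬ (P ⊆ Q) → ∃ λ x → x ∈ P × x ∉ Q
⊈⇒∃∉ {P = P} {Q} P⊈Q with any? (λ x → (x ∈? P) ×-dec ¬? (x ∈? Q))
... | yes witness    = witness
... | no  no-witness = ⊥-elim (P⊈Q (λ {x} x∈P →
        decidable-stable (x ∈? Q) (λ x∉Q → no-witness (x , x∈P , x∉Q))))

-- Subsets of S ⊎ T are encoded as concatenations X ++ Y with X ⊆ S, Y ⊆ T.

take-++ : ∀ {s t} (X : Subset s) (Y : Subset t) → take s (X ++ Y) ≡ X
take-++ []      Y = refl
take-++ (b ∷ X) Y = cong (b ∷_) (take-++ X Y)

drop-++ : ∀ {s t} (X : Subset s) (Y : Subset t) → drop s (X ++ Y) ≡ Y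
drop-++ []      Y = refl
drop-++ (b ∷ X) Y = drop-++ X Y

split-++ : ∀ s {t} (Z : Subset (s + t)) → Z ≡ take s Z ++ drop s Z
split-++ s Z = sym (take++drop≡id s Z)

by-split : ∀ {s t ℓ} (P : Subset (s + t) → Set ℓ) → (∀ X Y → P (X ++ Y)) → ∀ Z → P Z
by-split {s} P P-++ Z = subst P (sym (split-++ s Z)) (P-++ (take s Z) (drop s Z))

∣++∣ : ∀ {s t} (X : Subset s) (Y : Subset t) → ∣ X ++ Y ∣ ≡ ∣ X ∣ + ∣ Y ∣
∣++∣ []             Y = refl
∣++∣ (inside  ∷ X) Y = cong suc (∣++∣ X Y)
∣++∣ (outside ∷ X) Y = ∣++∣ X Y

⊥-++ : ∀ s {t} → ⊥ {s + t} ≡ ⊥ {s} ++ ⊥ {t}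
⊥-++ zero    = refl
⊥-++ (suc s) = cong (outside ∷_) (⊥-++ s)

take-⊆ : ∀ s {t} {Z W : Subset (s + t)} → Z ⊆ W → take s Z ⊆ take s W
take-⊆ (suc s) {Z = _ ∷ Z} {_ ∷ W} Z⊆W here with Z⊆W (here {xs = Z})
... | here = here
take-⊆ (suc s) {Z = _ ∷ Z} {_ ∷ W} Z⊆W (there x∈Z) = there (take-⊆ s (drop-∷-⊆ Z⊆W) x∈Z)

drop-⊆ : ∀ s {t} {Z W : Subset (s + t)} → Z ⊆ W → drop s Z ⊆ drop s W
drop-⊆ zero                        Z⊆W = Z⊆W
drop-⊆ (suc s) {Z = _ ∷ Z} {_ ∷ W} Z⊆W = drop-⊆ s (drop-∷-⊆ Z⊆W)

module _ {s t : ℕ} where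

  ∈-++ˡ : ∀ {X : Subset s} {Y : Subset t} {x} → x ∈ X ⇔ (x ↑ˡ t) ∈ X ++ Y
  ∈-++ˡ {X} {Y} {x} = mk⇔
    (λ x∈X → lookup⇒[]= _ (X ++ Y) (trans (lookup-++ˡ X Y x) ([]=⇒lookup x∈X)))
    (λ x∈X++Y → lookup⇒[]= x X (trans (sym (lookup-++ˡ X Y x)) ([]=⇒lookup x∈X++Y)))

  ∈-++ʳ : ∀ {X : Subset s} {Y : Subset t} {y} → y ∈ Y ⇔ (s ↑ʳ y) ∈ X ++ Y
  ∈-++ʳ {X} {Y} {y} = mk⇔
    (λ y∈Y → lookup⇒[]= _ (X ++ Y) (trans (lookup-++ʳ X Y y) ([]=⇒lookup y∈Y)))
    (λ y∈X++Y → lookup⇒[]= y Y (trans (sym (lookup-++ʳ X Y y)) ([]=⇒lookup y∈X++Y)))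

  ++-∪ : ∀ (X X′ : Subset s) (Y Y′ : Subset t) → (X ++ Y) ∪ (X′ ++ Y′) ≡ (X ∪ X′) ++ (Y ∪ Y′)
  ++-∪ X X′ Y Y′ = zipWith-++ _∨_ X Y X′ Y′

  ++-∩ : ∀ (X X′ : Subset s) (Y Y′ : Subset t) → (X ++ Y) ∩ (X′ ++ Y′) ≡ (X ∩ X′) ++ (Y ∩ Y′)
  ++-∩ X X′ Y Y′ = zipWith-++ _∧_ X Y X′ Y′

⁅↑ˡ⁆ : ∀ {s} t (x : Fin s) → ⁅ x ↑ˡ t ⁆ ≡ ⁅ x ⁆ ++ ⊥ {t}
⁅↑ˡ⁆ {suc s} t zero    = cong (inside ∷_) (⊥-++ s)
⁅↑ˡ⁆         t (suc x) = cong (outside ∷_) (⁅↑ˡ⁆ t x)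

⁅↑ʳ⁆ : ∀ s {t} (y : Fin t) → ⁅ s ↑ʳ y ⁆ ≡ ⊥ {s} ++ ⁅ y ⁆
⁅↑ʳ⁆ zero    y = refl
⁅↑ʳ⁆ (suc s) y = cong (outside ∷_) (⁅↑ʳ⁆ s y)

module _ {s t : ℕ} (X : Subset s) (Y : Subset t) where

  -++ˡ : ∀ x → (X ++ Y) - (x ↑ˡ t) ≡ (X - x) ++ Y
  -++ˡ x = begin
    (X ++ Y) ─ ⁅ x ↑ˡ t ⁆   ≡⟨ cong ((X ++ Y) ─_) (⁅↑ˡ⁆ t x) ⟩
    (X ++ Y) ─ (⁅ x ⁆ ++ ⊥) ≡⟨ zipWith-++ _ X Y ⁅ x ⁆ ⊥ ⟩
    (X - x) ++ (Y ─ ⊥)      ≡⟨ cong ((X - x) ++_) (p─⊥≡p Y) ⟩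
    (X - x) ++ Y            ∎
    where open ≡-Reasoning

  -++ʳ : ∀ y → (X ++ Y) - (s ↑ʳ y) ≡ X ++ (Y - y)
  -++ʳ y = begin
    (X ++ Y) ─ ⁅ s ↑ʳ y ⁆   ≡⟨ cong ((X ++ Y) ─_) (⁅↑ʳ⁆ s y) ⟩
    (X ++ Y) ─ (⊥ ++ ⁅ y ⁆) ≡⟨ zipWith-++ _ X Y ⊥ ⁅ y ⁆ ⟩
    (X ─ ⊥) ++ (Y - y)      ≡⟨ cong (_++ (Y - y)) (p─⊥≡p X) ⟩
    X ++ (Y - y)            ∎
    where open ≡-Reasoning

  ∪++ˡ : ∀ x → (X ++ Y) ∪ ⁅ x ↑ˡ t ⁆ ≡ (X ∪ ⁅ x ⁆) ++ Y
  ∪++ˡ x = begin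
    (X ++ Y) ∪ ⁅ x ↑ˡ t ⁆   ≡⟨ cong ((X ++ Y) ∪_) (⁅↑ˡ⁆ t x) ⟩
    (X ++ Y) ∪ (⁅ x ⁆ ++ ⊥) ≡⟨ ++-∪ X ⁅ x ⁆ Y ⊥ ⟩
    (X ∪ ⁅ x ⁆) ++ (Y ∪ ⊥)  ≡⟨ cong ((X ∪ ⁅ x ⁆) ++_) (∪-identityʳ Y) ⟩
    (X ∪ ⁅ x ⁆) ++ Y        ∎
    where open ≡-Reasoning

  ∪++ʳ : ∀ y → (X ++ Y) ∪ ⁅ s ↑ʳ y ⁆ ≡ X ++ (Y ∪ ⁅ y ⁆)
  ∪++ʳ y = begin
    (X ++ Y) ∪ ⁅ s ↑ʳ y ⁆   ≡⟨ cong ((X ++ Y) ∪_) (⁅↑ʳ⁆ s y) ⟩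
    (X ++ Y) ∪ (⊥ ++ ⁅ y ⁆) ≡⟨ ++-∪ X ⊥ Y ⁅ y ⁆ ⟩
    (X ∪ ⊥) ++ (Y ∪ ⁅ y ⁆)  ≡⟨ cong (_++ (Y ∪ ⁅ y ⁆)) (∪-identityʳ X) ⟩
    X ++ (Y ∪ ⁅ y ⁆)        ∎
    where open ≡-Reasoning

↑-cases : ∀ s {t} (z : Fin (s + t)) → (∃ λ x → z ≡ x ↑ˡ t) ⊎ (∃ λ y → z ≡ s ↑ʳ y)
↑-cases zero    y       = inj₂ (y , refl)
↑-cases (suc s) zero    = inj₁ (zero , refl)
↑-cases (suc s) (suc z) with ↑-cases s z
... | inj₁ (x , refl) = inj₁ (suc x , refl)
... | inj₂ (y , refl) = inj₂ (y , refl)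

RankCyclic : ∀ {n} → (Subset n → ℕ) → Subset n → Set
RankCyclic ρ X = ∀ x → x ∈ X → ρ (X - x) ≡ ρ X

RankFlat : ∀ {n} → (Subset n → ℕ) → Subset n → Set
RankFlat ρ X = ∀ x → x ∉ X → ρ (X ∪ ⁅ x ⁆) ≢ ρ X

RankCyclicFlat : ∀ {n} → (Subset n → ℕ) → Subset n → Set
RankCyclicFlat ρ X = RankCyclic ρ X × RankFlat ρ X

on++ : ∀ {s t} → (Subset s → Subset t → ℕ) → Subset (s + t) → ℕ
on++ {s} φ Z = φ (take s Z) (drop s Z)

module _ {s t : ℕ} (φ : Subset s → Subset t → ℕ) where

  on++-≡ : ∀ {Z} {X : Subset s} {Y : Subset t} → Z ≡ X ++ Y → on++ φ Z ≡ φ X Y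
  on++-≡ {X = X} {Y} refl = cong₂ φ (take-++ X Y) (drop-++ X Y)

  on++-ind⇔ : ∀ X Y → IndR (on++ φ) (X ++ Y) ⇔ (φ X Y ≡ ∣ X ∣ + ∣ Y ∣)
  on++-ind⇔ X Y = mk⇔
    (λ ind → trans (sym (on++-≡ refl)) (trans ind (∣++∣ X Y)))
    (λ eq → trans (on++-≡ refl) (trans eq (sym (∣++∣ X Y))))

  rankCyclicFlat-++⇔ : ∀ X Y → RankCyclicFlat (on++ φ) (X ++ Y)
                     ⇔ (RankCyclicFlat (λ X′ → φ X′ Y) X × RankCyclicFlat (φ X) Y)
  rankCyclicFlat-++⇔ X Y = mk⇔ split join
    where
    read : ∀ {Z Z′ X′ Y′ X″ Y″} → Z ≡ X′ ++ Y′ → Z′ ≡ X″ ++ Y″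
         → on++ φ Z ≡ on++ φ Z′ → φ X′ Y′ ≡ φ X″ Y″
    read e e′ eq = trans (sym (on++-≡ e)) (trans eq (on++-≡ e′))

    split : RankCyclicFlat (on++ φ) (X ++ Y)
          → RankCyclicFlat (λ X′ → φ X′ Y) X × RankCyclicFlat (φ X) Y
    split (cyclic , flat) =
      ( (λ x x∈X → read (-++ˡ X Y x) refl (cyclic (x ↑ˡ t) (Equivalence.to ∈-++ˡ x∈X)))
      , (λ x x∉X eq → flat (x ↑ˡ t) (x∉X ∘ Equivalence.from ∈-++ˡ) (read′ (∪++ˡ X Y x) eq)) )
      , ( (λ y y∈Y → read (-++ʳ X Y y) refl (cyclic (s ↑ʳ y) (Equivalence.to ∈-++ʳ y∈Y)))
        , (λ y y∉Y eq → flat (s ↑ʳ y) (y∉Y ∘ Equivalence.from ∈-++ʳ) (read′ (∪++ʳ X Y y) eq)) )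
      where
      read′ : ∀ {Z X′ Y′} → Z ≡ X′ ++ Y′ → φ X′ Y′ ≡ φ X Y → on++ φ Z ≡ on++ φ (X ++ Y)
      read′ e eq = trans (on++-≡ e) (trans eq (sym (on++-≡ refl)))

    join : RankCyclicFlat (λ X′ → φ X′ Y) X × RankCyclicFlat (φ X) Y
         → RankCyclicFlat (on++ φ) (X ++ Y)
    join ((cyclicˣ , flatˣ) , (cyclicʸ , flatʸ)) = cyclic , flat
      where
      cyclic : RankCyclic (on++ φ) (X ++ Y)
      cyclic z z∈ with ↑-cases s z
      ... | inj₁ (x , refl) = trans (on++-≡ (-++ˡ X Y x))
          (trans (cyclicˣ x (Equivalence.from ∈-++ˡ z∈)) (sym (on++-≡ refl)))
      ... | inj₂ (y , refl) = trans (on++-≡ (-++ʳ X Y y))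
          (trans (cyclicʸ y (Equivalence.from ∈-++ʳ z∈)) (sym (on++-≡ refl)))
      flat : RankFlat (on++ φ) (X ++ Y)
      flat z z∉ eq with ↑-cases s z
      ... | inj₁ (x , refl) = flatˣ x (z∉ ∘ Equivalence.to ∈-++ˡ) (read (∪++ˡ X Y x) refl eq)
      ... | inj₂ (y , refl) = flatʸ y (z∉ ∘ Equivalence.to ∈-++ʳ) (read (∪++ʳ X Y y) refl eq)

Submodular : ∀ {n} → (Subset n → ℕ) → Set
Submodular φ = ∀ P Q → φ (P ∪ Q) + φ (P ∩ Q) ≤ φ P + φ Q

Monotone : ∀ {n} → (Subset n → ℕ) → Set
Monotone φ = ∀ {P Q} → P ⊆ Q → φ P ≤ φ Q

change⇒increase : ∀ {n} {φ : Subset n → ℕ} → Monotone φ → ∀ {P x}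
                → φ (P ∪ ⁅ x ⁆) ≢ φ P → φ P < φ (P ∪ ⁅ x ⁆)
change⇒increase mono changed = ≤∧≢⇒< (mono (p⊆p∪q _)) (changed ∘ sym)

Submodular₂ : ∀ {s t} → (Subset s → Subset t → ℕ) → Set
Submodular₂ φ = ∀ X X′ Y Y′ → φ (X ∪ X′) (Y ∪ Y′) + φ (X ∩ X′) (Y ∩ Y′) ≤ φ X Y + φ X′ Y′

∣∣-submodular : ∀ {n} → Submodular {n} ∣_∣
∣∣-submodular P Q = ≤-reflexive (∣p∪q∣+∣p∩q∣≡∣p∣+∣q∣ P Q)

module _ {n : ℕ} (φ : Subset n → ℕ) (submod : Submodular φ) (mono : Monotone φ) where

  submodular-⊆ : ∀ {P Q U V} → U ⊆ P ∪ Q → V ⊆ P ∩ Q → φ U + φ V ≤ φ P + φ Q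
  submodular-⊆ {P} {Q} U⊆ V⊆ = ≤-trans (+-mono-≤ (mono U⊆) (mono V⊆)) (submod P Q)

  ∪-submodular : ∀ C → Submodular (λ X → φ (X ∪ C))
  ∪-submodular C P Q = submodular-⊆ ∪∪⊆ ∩∪⊆
    where
    ∪∪⊆ : (P ∪ Q) ∪ C ⊆ (P ∪ C) ∪ (Q ∪ C)
    ∪∪⊆ = ∪-⊆ (∪-mono (p⊆p∪q C) (p⊆p∪q C)) (p⊆p∪q (Q ∪ C) ∘ q⊆p∪q P C)
    ∩∪⊆ : (P ∩ Q) ∪ C ⊆ (P ∪ C) ∩ (Q ∪ C)
    ∩∪⊆ x∈ = x∈p∩q⁺ (∪-mono (p∩q⊆p P Q) ⊆-refl x∈ , ∪-mono (p∩q⊆q P Q) ⊆-refl x∈)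

  ∩-submodular : ∀ C → Submodular (λ X → φ (X ∩ C))
  ∩-submodular C P Q = submodular-⊆ ∪∩⊆ ∩∩⊆
    where
    ∪∩⊆ : (P ∪ Q) ∩ C ⊆ (P ∩ C) ∪ (Q ∩ C)
    ∪∩⊆ x∈ with x∈p∩q⁻ (P ∪ Q) C x∈
    ... | x∈P∪Q , x∈C with x∈p∪q⁻ P Q x∈P∪Q
    ... | inj₁ x∈P = p⊆p∪q (Q ∩ C) (x∈p∩q⁺ (x∈P , x∈C))
    ... | inj₂ x∈Q = q⊆p∪q (P ∩ C) (Q ∩ C) (x∈p∩q⁺ (x∈Q , x∈C))
    ∩∩⊆ : (P ∩ Q) ∩ C ⊆ (P ∩ C) ∩ (Q ∩ C)
    ∩∩⊆ x∈ with x∈p∩q⁻ (P ∩ Q) C x∈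
    ... | x∈P∩Q , x∈C = let x∈P , x∈Q = x∈p∩q⁻ P Q x∈P∩Q in
      x∈p∩q⁺ (x∈p∩q⁺ (x∈P , x∈C) , x∈p∩q⁺ (x∈Q , x∈C))

+-submodular : ∀ {n} (φ ψ : Subset n → ℕ) → Submodular φ → Submodular ψ
             → Submodular (λ X → φ X + ψ X)
+-submodular φ ψ φ-sub ψ-sub P Q = begin
  (φ (P ∪ Q) + ψ (P ∪ Q)) + (φ (P ∩ Q) + ψ (P ∩ Q)) ≡⟨ interchange (φ (P ∪ Q)) _ _ _ ⟩
  (φ (P ∪ Q) + φ (P ∩ Q)) + (ψ (P ∪ Q) + ψ (P ∩ Q)) ≤⟨ +-mono-≤ (φ-sub P Q) (ψ-sub P Q) ⟩
  (φ P + φ Q) + (ψ P + ψ Q)                         ≡⟨ interchange (φ P) _ _ _ ⟩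
  (φ P + ψ P) + (φ Q + ψ Q)                         ∎
  where open ≤-Reasoning

module _ {s t : ℕ} where

  separable-submodular : ∀ (φ : Subset s → ℕ) (ψ : Subset t → ℕ) → Submodular φ → Submodular ψ
                       → Submodular₂ (λ X Y → φ X + ψ Y)
  separable-submodular φ ψ φ-sub ψ-sub X X′ Y Y′ = begin
    (φ (X ∪ X′) + ψ (Y ∪ Y′)) + (φ (X ∩ X′) + ψ (Y ∩ Y′)) ≡⟨ interchange (φ (X ∪ X′)) _ _ _ ⟩
    (φ (X ∪ X′) + φ (X ∩ X′)) + (ψ (Y ∪ Y′) + ψ (Y ∩ Y′)) ≤⟨ +-mono-≤ (φ-sub X X′) (ψ-sub Y Y′) ⟩
    (φ X + φ X′) + (ψ Y + ψ Y′)                           ≡⟨ interchange (φ X) _ _ _ ⟩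
    (φ X + ψ Y) + (φ X′ + ψ Y′)                           ∎
    where open ≤-Reasoning

  Monotone₂ : (Subset s → Subset t → ℕ) → Set
  Monotone₂ φ = ∀ {X X′ Y Y′} → X ⊆ X′ → Y ⊆ Y′ → φ X Y ≤ φ X′ Y′

  ⊓-submodular : ∀ {φ ψ : Subset s → Subset t → ℕ} → Submodular₂ φ → Submodular₂ ψ
               → (∀ X X′ Y Y′ → φ (X ∪ X′) (Y ∪ Y′) + ψ (X ∩ X′) (Y ∩ Y′) ≤ φ X Y + ψ X′ Y′)
               → Submodular₂ (λ X Y → φ X Y ⊓ ψ X Y)
  ⊓-submodular {φ} {ψ} φ-sub ψ-sub mixed X X′ Y Y′ =
    by-cases (⊓-sel (φ X Y) (ψ X Y)) (⊓-sel (φ X′ Y′) (ψ X′ Y′))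
    where
    σ : Subset s → Subset t → ℕ
    σ X Y = φ X Y ⊓ ψ X Y

    σ≤φ : ∀ X Y → σ X Y ≤ φ X Y
    σ≤φ X Y = m⊓n≤m (φ X Y) (ψ X Y)

    σ≤ψ : ∀ X Y → σ X Y ≤ ψ X Y
    σ≤ψ X Y = m⊓n≤n (φ X Y) (ψ X Y)

    lhs : ℕ
    lhs = σ (X ∪ X′) (Y ∪ Y′) + σ (X ∩ X′) (Y ∩ Y′)

    mixed′ : φ (X ∪ X′) (Y ∪ Y′) + ψ (X ∩ X′) (Y ∩ Y′) ≤ ψ X Y + φ X′ Y′
    mixed′ = begin
      φ (X ∪ X′) (Y ∪ Y′) + ψ (X ∩ X′) (Y ∩ Y′)
        ≡⟨ cong₂ _+_ (cong₂ φ (∪-comm X X′) (∪-comm Y Y′)) (cong₂ ψ (∩-comm X X′) (∩-comm Y Y′)) ⟩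
      φ (X′ ∪ X) (Y′ ∪ Y) + ψ (X′ ∩ X) (Y′ ∩ Y) ≤⟨ mixed X′ X Y′ Y ⟩
      φ X′ Y′ + ψ X Y                           ≡⟨ +-comm (φ X′ Y′) (ψ X Y) ⟩
      ψ X Y + φ X′ Y′                           ∎
      where open ≤-Reasoning

    by-cases : σ X Y ≡ φ X Y ⊎ σ X Y ≡ ψ X Y → σ X′ Y′ ≡ φ X′ Y′ ⊎ σ X′ Y′ ≡ ψ X′ Y′
             → lhs ≤ σ X Y + σ X′ Y′
    by-cases (inj₁ σ≡φ) (inj₁ σ′≡φ′) = subst₂ (λ a b → lhs ≤ a + b) (sym σ≡φ) (sym σ′≡φ′)
      (≤-trans (+-mono-≤ (σ≤φ _ _) (σ≤φ _ _)) (φ-sub X X′ Y Y′))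
    by-cases (inj₂ σ≡ψ) (inj₂ σ′≡ψ′) = subst₂ (λ a b → lhs ≤ a + b) (sym σ≡ψ) (sym σ′≡ψ′)
      (≤-trans (+-mono-≤ (σ≤ψ _ _) (σ≤ψ _ _)) (ψ-sub X X′ Y Y′))
    by-cases (inj₁ σ≡φ) (inj₂ σ′≡ψ′) = subst₂ (λ a b → lhs ≤ a + b) (sym σ≡φ) (sym σ′≡ψ′)
      (≤-trans (+-mono-≤ (σ≤φ _ _) (σ≤ψ _ _)) (mixed X X′ Y Y′))
    by-cases (inj₂ σ≡ψ) (inj₁ σ′≡φ′) = subst₂ (λ a b → lhs ≤ a + b) (sym σ≡ψ) (sym σ′≡φ′)
      (≤-trans (+-mono-≤ (σ≤φ _ _) (σ≤ψ _ _)) mixed′)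

  on++-submodular : ∀ {φ : Subset s → Subset t → ℕ} → Submodular₂ φ → Submodular (on++ φ)
  on++-submodular {φ} φ-sub P Q = subst (_≤ on++ φ P + on++ φ Q)
    (sym (cong₂ _+_ (on++-≡ φ ∪-split) (on++-≡ φ ∩-split)))
    (φ-sub (take s P) (take s Q) (drop s P) (drop s Q))
    where
    ∪-split : P ∪ Q ≡ (take s P ∪ take s Q) ++ (drop s P ∪ drop s Q)
    ∪-split = trans (cong₂ _∪_ (split-++ s P) (split-++ s Q))
                    (++-∪ (take s P) (take s Q) (drop s P) (drop s Q))
    ∩-split : P ∩ Q ≡ (take s P ∩ take s Q) ++ (drop s P ∩ drop s Q)
    ∩-split = trans (cong₂ _∩_ (split-++ s P) (split-++ s Q))
                    (++-∩ (take s P) (take s Q) (drop s P) (drop s Q))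

  on++-monotone : ∀ {φ : Subset s → Subset t → ℕ} → Monotone₂ φ → Monotone (on++ φ)
  on++-monotone φ-mono P⊆Q = φ-mono (take-⊆ s P⊆Q) (drop-⊆ s P⊆Q)

cyclicFlat-transfer : ∀ {n} {Ind Ind′ : Subset n → Set}
                    → (∀ I → Ind I → Ind′ I) → (∀ I → Ind′ I → Ind I)
                    → ∀ X → CyclicFlat Ind X → CyclicFlat Ind′ X
cyclicFlat-transfer {Ind = Ind} {Ind′} to from X (cyclic , flat) = cyclic′ , flat′
  where
  circuit′ : ∀ {C} → Circuit Ind C → Circuit Ind′ C
  circuit′ {C} (C-dep , minimal) = C-dep ∘ from C , λ D D⊂C → to D (minimal D D⊂C)

  hasRank : ∀ {Y k} → HasRank Ind′ Y k → HasRank Ind Y k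
  hasRank ((I , I⊆Y , I-ind , ∣I∣≡k) , maximal) =
    (I , I⊆Y , from I I-ind , ∣I∣≡k) , λ J J⊆Y J-ind → maximal J J⊆Y (to J J-ind)

  cyclic′ : Cyclic Ind′ X
  cyclic′ x x∈X = let C , C-circuit , C⊆X , x∈C = cyclic x x∈X in C , circuit′ C-circuit , C⊆X , x∈C

  flat′ : Flat Ind′ X
  flat′ e e∉X k X-rank X∪e-rank = flat e e∉X k (hasRank X-rank) (hasRank X∪e-rank)

cyclicFlat-resp-⇔ : ∀ {n} {Ind Ind′ : Subset n → Set} → (∀ I → Ind I ⇔ Ind′ I)
                  → ∀ X → CyclicFlat Ind X ⇔ CyclicFlat Ind′ X
cyclicFlat-resp-⇔ Ind⇔Ind′ X = mk⇔
  (cyclicFlat-transfer (Equivalence.to ∘ Ind⇔Ind′) (Equivalence.from ∘ Ind⇔Ind′) X)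
  (cyclicFlat-transfer (Equivalence.from ∘ Ind⇔Ind′) (Equivalence.to ∘ Ind⇔Ind′) X)

module Rank {n : ℕ} (m : Matroid n) where

  ρ : Subset n → ℕ
  ρ = r m

  Ind : Subset n → Set
  Ind = IndR ρ

  mono : Monotone ρ
  mono {X} {Y} = r-mono m X Y

  ∪-bound : ∀ X D → ρ (X ∪ D) ≤ ρ X + ∣ D ∣
  ∪-bound X D = begin
    ρ (X ∪ D)             ≤⟨ m≤m+n _ _ ⟩
    ρ (X ∪ D) + ρ (X ∩ D) ≤⟨ r-submod m X D ⟩
    ρ X + ρ D             ≤⟨ +-monoʳ-≤ (ρ X) (r-bound m D) ⟩
    ρ X + ∣ D ∣           ∎
    where open ≤-Reasoning

  ∪⁅x⁆-bound : ∀ X x → ρ (X ∪ ⁅ x ⁆) ≤ suc (ρ X)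
  ∪⁅x⁆-bound X x =
    subst (ρ (X ∪ ⁅ x ⁆) ≤_) (trans (cong (ρ X +_) (∣⁅x⁆∣≡1 x)) (+-comm (ρ X) 1)) (∪-bound X ⁅ x ⁆)

  Spans : Subset n → Subset n → Set
  Spans X D = ρ (X ∪ D) ≡ ρ X

  spans-⊆ : ∀ {X W} D → X ⊆ W → Spans X D → Spans W D
  spans-⊆ {X} {W} D X⊆W X-spans = ≤-antisym (+-cancelˡ-≤ (ρ X) _ _ ρX+ρW∪D≤) (mono (p⊆p∪q D))
    where
    W∪D⊆ : W ∪ D ⊆ (X ∪ D) ∪ W
    W∪D⊆ y∈W∪D with x∈p∪q⁻ W D y∈W∪D
    ... | inj₁ y∈W = q⊆p∪q (X ∪ D) W y∈W
    ... | inj₂ y∈D = p⊆p∪q W (q⊆p∪q X D y∈D)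

    X⊆ : X ⊆ (X ∪ D) ∩ W
    X⊆ x∈X = x∈p∩q⁺ (p⊆p∪q D x∈X , X⊆W x∈X)

    ρX+ρW∪D≤ : ρ X + ρ (W ∪ D) ≤ ρ X + ρ W
    ρX+ρW∪D≤ = begin
      ρ X + ρ (W ∪ D)                   ≡⟨ +-comm (ρ X) _ ⟩
      ρ (W ∪ D) + ρ X                   ≤⟨ +-mono-≤ (mono W∪D⊆) (mono X⊆) ⟩
      ρ ((X ∪ D) ∪ W) + ρ ((X ∪ D) ∩ W) ≤⟨ r-submod m (X ∪ D) W ⟩
      ρ (X ∪ D) + ρ W                   ≡⟨ cong (_+ ρ W) X-spans ⟩
      ρ X + ρ W                         ∎
      where open ≤-Reasoning

  hereditary : ∀ {I J} → Ind I → J ⊆ I → Ind J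
  hereditary {I} {J} I-ind J⊆I = ≤-antisym (r-bound m J) (+-cancelʳ-≤ ∣ I ∩ ∁ J ∣ _ _ ∣J∣+∣I∖J∣≤)
    where
    I⊆ : I ⊆ J ∪ (I ∩ ∁ J)
    I⊆ {x} x∈I with x ∈? J
    ... | yes x∈J = p⊆p∪q _ x∈J
    ... | no  x∉J = q⊆p∪q J _ (x∈p∩q⁺ (x∈I , x∉p⇒x∈∁p x∉J))

    ∣J∣+∣I∖J∣≤ : ∣ J ∣ + ∣ I ∩ ∁ J ∣ ≤ ρ J + ∣ I ∩ ∁ J ∣
    ∣J∣+∣I∖J∣≤ = begin
      ∣ J ∣ + ∣ I ∩ ∁ J ∣     ≤⟨ +-monoˡ-≤ _ (p⊆q⇒∣p∣≤∣q∣ (λ x∈J → x∈p∩q⁺ (J⊆I x∈J , x∈J))) ⟩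
      ∣ I ∩ J ∣ + ∣ I ∩ ∁ J ∣ ≡⟨ ∣p∩q∣+∣p∩∁q∣≡∣p∣ I J ⟩
      ∣ I ∣                   ≡⟨ sym I-ind ⟩
      ρ I                     ≤⟨ mono I⊆ ⟩
      ρ (J ∪ (I ∩ ∁ J))       ≤⟨ ∪-bound J _ ⟩
      ρ J + ∣ I ∩ ∁ J ∣       ∎
      where open ≤-Reasoning

  -- An independent J ⊆ W of size ρ W extends to one of size ρ (W ∪ ⁅ x ⁆):
  -- either W spans x already or J ∪ ⁅ x ⁆ is independent.
  basis-step : ∀ {J W} x → J ⊆ W → Ind J → ∣ J ∣ ≡ ρ W
             → ∃[ J′ ] (J ⊆ J′ × J′ ⊆ W ∪ ⁅ x ⁆ × Ind J′ × ∣ J′ ∣ ≡ ρ (W ∪ ⁅ x ⁆))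
  basis-step {J} {W} x J⊆W J-ind ∣J∣≡ρW with ρ (J ∪ ⁅ x ⁆) ≟ ρ J
  ... | yes J-spans-x =
    J , ⊆-refl , p⊆p∪q _ ∘ J⊆W , J-ind , trans ∣J∣≡ρW (sym (spans-⊆ ⁅ x ⁆ J⊆W J-spans-x))
  ... | no ¬J-spans-x =
    J ∪ ⁅ x ⁆ , p⊆p∪q _ , ∪-mono J⊆W ⊆-refl , J∪x-ind , sym ρW∪x≡
    where
    x∉J : x ∉ J
    x∉J x∈J = ¬J-spans-x (cong ρ (p∪⁅x⁆≡p J x x∈J))
    ∣J∪x∣ : ∣ J ∪ ⁅ x ⁆ ∣ ≡ suc ∣ J ∣
    ∣J∪x∣ = ∣p∪⁅x⁆∣≡1+∣p∣ J x x∉J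
    ρJ∪x : ρ (J ∪ ⁅ x ⁆) ≡ suc (ρ J)
    ρJ∪x = ≤-antisym (∪⁅x⁆-bound J x) (change⇒increase mono ¬J-spans-x)
    J∪x-ind : Ind (J ∪ ⁅ x ⁆)
    J∪x-ind = trans ρJ∪x (trans (cong suc J-ind) (sym ∣J∪x∣))
    ρW∪x≡ : ρ (W ∪ ⁅ x ⁆) ≡ ∣ J ∪ ⁅ x ⁆ ∣
    ρW∪x≡ = ≤-antisym
      (subst (ρ (W ∪ ⁅ x ⁆) ≤_) (trans (cong suc (sym ∣J∣≡ρW)) (sym ∣J∪x∣)) (∪⁅x⁆-bound W x))
      (subst (_≤ ρ (W ∪ ⁅ x ⁆)) J∪x-ind (mono (∪-mono J⊆W ⊆-refl)))

  ⊥-ind : Ind ⊥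
  ⊥-ind = ≤-antisym (r-bound m ⊥) (subst (_≤ ρ ⊥) (sym (∣⊥∣≡0 n)) z≤n)

  extend-to-basis : ∀ {I X} → I ⊆ X → Ind I
                  → ∃[ J ] (I ⊆ J × J ⊆ X × Ind J × ∣ J ∣ ≡ ρ X)
  extend-to-basis {I} {X} I⊆X I-ind =
    subst BasisAbove (⊆-antisym (∪-⊆ I⊆X ⊆-refl) (q⊆p∪q I X))
      (subset-ind (λ D → BasisAbove (I ∪ D)) base step X)
    where
    BasisAbove : Subset n → Set
    BasisAbove W = ∃[ J ] (I ⊆ J × J ⊆ W × Ind J × ∣ J ∣ ≡ ρ W)

    base : BasisAbove (I ∪ ⊥)
    base = I , ⊆-refl , p⊆p∪q ⊥ , I-ind , trans (sym I-ind) (cong ρ (sym (∪-identityʳ I)))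

    step : ∀ D x → BasisAbove (I ∪ D) → BasisAbove (I ∪ (D ∪ ⁅ x ⁆))
    step D x (J , I⊆J , J⊆I∪D , J-ind , ∣J∣≡) =
      subst BasisAbove (∪-assoc I D ⁅ x ⁆)
        (let J′ , J⊆J′ , rest = basis-step x J⊆I∪D J-ind ∣J∣≡ in J′ , J⊆J′ ∘ I⊆J , rest)

  hasRank : ∀ X → HasRank Ind X (ρ X)
  hasRank X =
    (let J , _ , J⊆X , J-ind , ∣J∣≡ρX = extend-to-basis ⊥⊆ ⊥-ind in J , J⊆X , J-ind , ∣J∣≡ρX)
    , λ I I⊆X I-ind → subst (_≤ ρ X) I-ind (mono I⊆X)

  hasRank-unique : ∀ X k → HasRank Ind X k → k ≡ ρ X
  hasRank-unique X k ((I , I⊆X , I-ind , ∣I∣≡k) , maximal) = ≤-antisym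
    (subst (_≤ ρ X) ∣I∣≡k (proj₂ (hasRank X) I I⊆X I-ind))
    (let J , J⊆X , J-ind , ∣J∣≡ρX = proj₁ (hasRank X) in subst (_≤ k) ∣J∣≡ρX (maximal J J⊆X J-ind))

  flat⇔ : ∀ X → Flat Ind X ⇔ RankFlat ρ X
  flat⇔ X = mk⇔
    (λ flat x x∉X eq → flat x x∉X (ρ X) (hasRank X)
                         (subst (HasRank Ind (X ∪ ⁅ x ⁆)) eq (hasRank (X ∪ ⁅ x ⁆))))
    (λ flat x x∉X k X-rank X∪x-rank →
       flat x x∉X (trans (sym (hasRank-unique _ k X∪x-rank)) (hasRank-unique X k X-rank)))

  redundant⇒spans : ∀ {X x} → x ∈ X → ρ (X - x) ≡ ρ X → Spans (X - x) ⁅ x ⁆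
  redundant⇒spans {X} x∈X ρX-x≡ρX = trans (cong ρ (p-x∪⁅x⁆≡p X x∈X)) (sym ρX-x≡ρX)

  spans⇒redundant : ∀ {X x Z} → x ∈ X → Z ⊆ X - x → Spans Z ⁅ x ⁆ → ρ (X - x) ≡ ρ X
  spans⇒redundant {X} {x} x∈X Z⊆X-x Z-spans-x = ≤-antisym (mono (p─q⊆p X ⁅ x ⁆)) (begin
    ρ X                   ≡⟨ cong ρ (sym (p-x∪⁅x⁆≡p X x∈X)) ⟩
    ρ ((X - x) ∪ ⁅ x ⁆)   ≡⟨ spans-⊆ ⁅ x ⁆ Z⊆X-x Z-spans-x ⟩
    ρ (X - x)             ∎)
    where open ≤-Reasoning

  circuit-redundant : ∀ {C z} → Circuit Ind C → z ∈ C → ρ (C - z) ≡ ρ C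
  circuit-redundant {C} {z} (C-dep , minimal) z∈C = ≤-antisym (mono (p─q⊆p C ⁅ z ⁆)) (begin
    ρ C           ≤⟨ ≤-pred (subst (ρ C <_) (∣p∣≡1+∣p-x∣ C z z∈C) (≤∧≢⇒< (r-bound m C) C-dep)) ⟩
    ∣ C - z ∣     ≡⟨ sym (minimal (C - z) (x∈p⇒p-x⊂p z∈C)) ⟩
    ρ (C - z)     ∎)
    where open ≤-Reasoning

  -- A dependent set D with D - z independent contains a circuit through z
  -- (a minimal dependent subset of D, found by induction on ∣D∣).
  circuit-through : ∀ {z} D → ¬ Ind D → z ∈ D → Ind (D - z)
                  → ∃[ C ] (Circuit Ind C × C ⊆ D × z ∈ C)
  circuit-through {z} = card-ind HasCircuit step
    where
    HasCircuit : Subset n → Set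
    HasCircuit D = ¬ Ind D → z ∈ D → Ind (D - z) → ∃[ C ] (Circuit Ind C × C ⊆ D × z ∈ C)

    step : ∀ D → (∀ D′ → ∣ D′ ∣ < ∣ D ∣ → HasCircuit D′) → HasCircuit D
    step D ih D-dep z∈D D-z-ind with anySubset? (λ D′ → (D′ ⊂? D) ×-dec ¬? (ρ D′ ≟ ∣ D′ ∣))
    ... | no no-smaller =
      D , (D-dep , λ D′ D′⊂D → decidable-stable (ρ D′ ≟ ∣ D′ ∣) λ D′-dep →
                                 no-smaller (D′ , D′⊂D , D′-dep))
        , ⊆-refl , z∈D
    ... | yes (D′ , D′⊂D , D′-dep) =
      let C , C-circuit , C⊆D′ , z∈C = ih D′ (p⊂q⇒∣p∣<∣q∣ D′⊂D) D′-dep z∈D′ D′-z-ind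
      in C , C-circuit , D′⊆D ∘ C⊆D′ , z∈C
      where
      D′⊆D : D′ ⊆ D
      D′⊆D = p⊂q⇒p⊆q D′⊂D
      D′-z-ind : Ind (D′ - z)
      D′-z-ind = hereditary D-z-ind (p⊆q⇒p-x⊆q-x D′⊆D)
      -- otherwise D′ ⊆ D - z would be independent
      z∈D′ : z ∈ D′
      z∈D′ = decidable-stable (z ∈? D′) λ z∉D′ → D′-dep (hereditary D-z-ind
        λ y∈D′ → x∈p∧x≢y⇒x∈p-y (D′⊆D y∈D′) λ { refl → z∉D′ y∈D′ })

  -- If deleting z ∈ X keeps the rank, X has a circuit through z: a basis I
  -- of X - z together with z is dependent, while (I ∪ ⁅ z ⁆) - z ⊆ I.
  redundant⇒circuit : ∀ {X z} → z ∈ X → ρ (X - z) ≡ ρ X → ∃[ C ] (Circuit Ind C × C ⊆ X × z ∈ C)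
  redundant⇒circuit {X} {z} z∈X ρX-z≡ρX with proj₁ (hasRank (X - z))
  ... | I , I⊆X-z , I-ind , ∣I∣≡ρX-z =
    let C , C-circuit , C⊆D , z∈C = circuit-through D D-dep z∈D D-z-ind
    in  C , C-circuit , D⊆X ∘ C⊆D , z∈C
    where
    D = I ∪ ⁅ z ⁆
    z∉I : z ∉ I
    z∉I z∈I = proj₂ (x∈p-y⁻ (I⊆X-z z∈I)) refl
    D⊆X : D ⊆ X
    D⊆X = ∪-⊆ (p─q⊆p X ⁅ z ⁆ ∘ I⊆X-z) (⁅x⁆⊆p z∈X)
    z∈D : z ∈ D
    z∈D = q⊆p∪q I ⁅ z ⁆ (x∈⁅x⁆ z)
    D-dep : ¬ Ind D
    D-dep D-ind = <-irrefl refl (begin-strict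
      ∣ D ∣      ≡⟨ sym D-ind ⟩
      ρ D        ≤⟨ mono D⊆X ⟩
      ρ X        ≡⟨ sym ρX-z≡ρX ⟩
      ρ (X - z)  ≡⟨ sym ∣I∣≡ρX-z ⟩
      ∣ I ∣      <⟨ n<1+n _ ⟩
      suc ∣ I ∣  ≡⟨ sym (∣p∪⁅x⁆∣≡1+∣p∣ I z z∉I) ⟩
      ∣ D ∣      ∎)
      where open ≤-Reasoning
    D-z-ind : Ind (D - z)
    D-z-ind = hereditary I-ind λ y∈D-z → let y∈D , y≢z = x∈p-y⁻ y∈D-z in
      [ id , (λ y∈⁅z⁆ → ⊥-elim (y≢z (x∈⁅y⁆⇒x≡y z y∈⁅z⁆))) ]′ (x∈p∪q⁻ I ⁅ z ⁆ y∈D)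

  cyclic⇔ : ∀ X → Cyclic Ind X ⇔ RankCyclic ρ X
  cyclic⇔ X = mk⇔ to (λ redundant z z∈X → redundant⇒circuit z∈X (redundant z z∈X))
    where
    to : Cyclic Ind X → RankCyclic ρ X
    to cyclic z z∈X with cyclic z z∈X
    ... | C , C-circuit , C⊆X , z∈C =
      spans⇒redundant z∈X (p⊆q⇒p-x⊆q-x C⊆X) (redundant⇒spans z∈C (circuit-redundant C-circuit z∈C))

  cyclicFlat⇔ : ∀ X → CyclicFlat Ind X ⇔ RankCyclicFlat ρ X
  cyclicFlat⇔ X = cyclic⇔ X ×-⇔ flat⇔ X

  ρ⊤≤ : ∀ P → ρ ⊤ ≤ ∣ P ∣ + ρ (∁ P)
  ρ⊤≤ P = begin
    ρ ⊤               ≡⟨ cong ρ (sym (trans (∪-comm (∁ P) P) (p∪∁p≡⊤ P))) ⟩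
    ρ (∁ P ∪ P)       ≤⟨ ∪-bound (∁ P) P ⟩
    ρ (∁ P) + ∣ P ∣   ≡⟨ +-comm (ρ (∁ P)) ∣ P ∣ ⟩
    ∣ P ∣ + ρ (∁ P)   ∎
    where open ≤-Reasoning

  dual-ind⇒spanning : ∀ {P} → IndR (dualRank m) P → ρ (∁ P) ≡ ρ ⊤
  dual-ind⇒spanning {P} P-ind = +-cancelˡ-≡ ∣ P ∣ _ _ (begin
    ∣ P ∣ + ρ (∁ P)               ≡⟨ sym (m∸n+n≡m (ρ⊤≤ P)) ⟩
    ∣ P ∣ + ρ (∁ P) ∸ ρ ⊤ + ρ ⊤   ≡⟨ cong (_+ ρ ⊤) P-ind ⟩
    ∣ P ∣ + ρ ⊤                   ∎)
    where open ≡-Reasoning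

  dual-dep⇒nonspanning : ∀ {P} → ¬ IndR (dualRank m) P → ρ (∁ P) < ρ ⊤
  dual-dep⇒nonspanning {P} P-dep = ≤∧≢⇒< (mono ⊆⊤)
    (λ spanning → P-dep (trans (cong (λ k → ∣ P ∣ + k ∸ ρ ⊤) spanning) (m+n∸n≡m ∣ P ∣ (ρ ⊤))))

  -- The complement of a cyclic set of the dual is a flat: otherwise some
  -- b ∈ B on a dual circuit C ⊆ B would be spanned by ∁ C, making the
  -- spanning set ∁ (C - b) no larger in rank than the non-spanning ∁ C.
  dual-cyclic⇒∁flat : ∀ {B} → Cyclic (IndR (dualRank m)) B → RankFlat ρ (∁ B)
  dual-cyclic⇒∁flat {B} cyclic b b∉∁B ∁B-spans-b
    with cyclic b (x∉∁p⇒x∈p b∉∁B)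
  ... | C , (C-dep , minimal) , C⊆B , b∈C = <-irrefl refl (begin-strict
    ρ (∁ C)               <⟨ dual-dep⇒nonspanning C-dep ⟩
    ρ ⊤                   ≡⟨ sym (dual-ind⇒spanning (minimal (C - b) (x∈p⇒p-x⊂p b∈C))) ⟩
    ρ (∁ (C - b))         ≤⟨ mono ∁C-b⊆ ⟩
    ρ (∁ C ∪ ⁅ b ⁆)       ≡⟨ spans-⊆ ⁅ b ⁆ (p⊆q⇒∁p⊇∁q C⊆B) ∁B-spans-b ⟩
    ρ (∁ C)               ∎)
    where
    open ≤-Reasoning
    ∁C-b⊆ : ∁ (C - b) ⊆ ∁ C ∪ ⁅ b ⁆
    ∁C-b⊆ {y} y∈ with y ≟ᶠ b
    ... | yes refl = q⊆p∪q (∁ C) ⁅ y ⁆ (x∈⁅x⁆ y)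
    ... | no  y≢b  = p⊆p∪q ⁅ b ⁆ (x∉p⇒x∈∁p (λ y∈C → x∈∁p⇒x∉p y∈ (x∈p∧x≢y⇒x∈p-y y∈C y≢b)))

squeeze : ∀ {a a′ b b′} → a′ ≤ a → b′ ≤ b → a + b ≤ a′ + b′ → a′ ≡ a × b′ ≡ b
squeeze {a} {a′} {b} {b′} a′≤a b′≤b a+b≤ =
  ≤-antisym a′≤a (+-cancelʳ-≤ b a a′ (≤-trans a+b≤ (+-monoʳ-≤ a′ b′≤b))) ,
  ≤-antisym b′≤b (+-cancelˡ-≤ a b b′ (≤-trans a+b≤ (+-monoˡ-≤ b′ a′≤a)))

-- Its rank at X ∪ Y is
-- the minimum σ X Y of two expressions: spanA puts X into the flat spanned by
-- A and counts Y in N, while freeB counts X in M and Y in N with the elements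
-- of B made free (coloops).
module PrincipalSum {s t : ℕ} (M : Matroid s) (N : Matroid t) (A : Subset s) (B : Subset t) where

  module RM = Rank M
  module RN = Rank N

  ρN-free : Subset t → ℕ
  ρN-free Y = RN.ρ (Y ∩ ∁ B) + ∣ Y ∩ B ∣

  spanA : Subset s → Subset t → ℕ
  spanA X Y = RM.ρ (X ∪ A) + RN.ρ Y

  freeB : Subset s → Subset t → ℕ
  freeB X Y = RM.ρ X + ρN-free Y

  σ : Subset s → Subset t → ℕ
  σ X Y = spanA X Y ⊓ freeB X Y

  σ≤spanA : ∀ X Y → σ X Y ≤ spanA X Y
  σ≤spanA X Y = m⊓n≤m (spanA X Y) (freeB X Y)

  σ≤freeB : ∀ X Y → σ X Y ≤ freeB X Y
  σ≤freeB X Y = m⊓n≤n (spanA X Y) (freeB X Y)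

  ∣Y∣-along-B : ∀ Y → ∣ Y ∩ ∁ B ∣ + ∣ Y ∩ B ∣ ≡ ∣ Y ∣
  ∣Y∣-along-B Y = trans (+-comm ∣ Y ∩ ∁ B ∣ _) (∣p∩q∣+∣p∩∁q∣≡∣p∣ Y B)

  freeB-bound : ∀ X Y → freeB X Y ≤ ∣ X ∣ + ∣ Y ∣
  freeB-bound X Y = +-mono-≤ (r-bound M X) (begin
    RN.ρ (Y ∩ ∁ B) + ∣ Y ∩ B ∣ ≤⟨ +-monoˡ-≤ _ (r-bound N _) ⟩
    ∣ Y ∩ ∁ B ∣ + ∣ Y ∩ B ∣    ≡⟨ ∣Y∣-along-B Y ⟩
    ∣ Y ∣                      ∎)
    where open ≤-Reasoning

  σ-monotone : Monotone₂ σ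
  σ-monotone X⊆X′ Y⊆Y′ = ⊓-mono-≤
    (+-mono-≤ (RM.mono (∪-mono X⊆X′ ⊆-refl)) (RN.mono Y⊆Y′))
    (+-mono-≤ (RM.mono X⊆X′) (+-mono-≤ (RN.mono (∩-mono Y⊆Y′ ⊆-refl))
                                        (p⊆q⇒∣p∣≤∣q∣ (∩-mono Y⊆Y′ ⊆-refl))))

  spanA-submodular : Submodular₂ spanA
  spanA-submodular = separable-submodular (λ X → RM.ρ (X ∪ A)) RN.ρ
    (∪-submodular RM.ρ (r-submod M) RM.mono A) (r-submod N)

  freeB-submodular : Submodular₂ freeB
  freeB-submodular = separable-submodular RM.ρ ρN-free (r-submod M)
    (+-submodular (λ Y → RN.ρ (Y ∩ ∁ B)) (λ Y → ∣ Y ∩ B ∣)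
      (∩-submodular RN.ρ (r-submod N) RN.mono (∁ B)) (∩-submodular ∣_∣ ∣∣-submodular p⊆q⇒∣p∣≤∣q∣ B))

  -- The mixed inequality in N: the elements of Y′ ∩ B outside Y, which spanA
  -- must pay for in N, are paid for by their free charge in ρN-free.
  ρN-mixed : ∀ Y Y′ → RN.ρ (Y ∪ Y′) + ρN-free (Y ∩ Y′) ≤ RN.ρ Y + ρN-free Y′
  ρN-mixed Y Y′ = begin
    RN.ρ (Y ∪ Y′) + (RN.ρ ((Y ∩ Y′) ∩ ∁ B) + ∣ (Y ∩ Y′) ∩ B ∣)
      ≤⟨ +-monoˡ-≤ _ (≤-trans (RN.mono Y∪Y′⊆) (RN.∪-bound W D)) ⟩
    (RN.ρ W + ∣ D ∣) + (RN.ρ ((Y ∩ Y′) ∩ ∁ B) + ∣ (Y ∩ Y′) ∩ B ∣)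
      ≡⟨ interchange (RN.ρ W) _ _ _ ⟩
    (RN.ρ W + RN.ρ ((Y ∩ Y′) ∩ ∁ B)) + (∣ D ∣ + ∣ (Y ∩ Y′) ∩ B ∣)
      ≤⟨ +-mono-≤ (submodular-⊆ RN.ρ (r-submod N) RN.mono ⊆-refl Y∩Y′∩∁B⊆) ∣D∣+∣Y∩Y′∩B∣≤ ⟩
    (RN.ρ Y + RN.ρ (Y′ ∩ ∁ B)) + ∣ Y′ ∩ B ∣
      ≡⟨ +-assoc (RN.ρ Y) _ _ ⟩
    RN.ρ Y + (RN.ρ (Y′ ∩ ∁ B) + ∣ Y′ ∩ B ∣) ∎
    where
    open ≤-Reasoning
    W = Y ∪ (Y′ ∩ ∁ B)
    D = (Y′ ∩ B) ∩ ∁ Y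

    Y∪Y′⊆ : Y ∪ Y′ ⊆ W ∪ D
    Y∪Y′⊆ {y} y∈ with x∈p∪q⁻ Y Y′ y∈ | y ∈? Y | y ∈? B
    ... | inj₁ y∈Y  | _        | _       = p⊆p∪q D (p⊆p∪q _ y∈Y)
    ... | inj₂ _    | yes y∈Y  | _       = p⊆p∪q D (p⊆p∪q _ y∈Y)
    ... | inj₂ y∈Y′ | no  y∉Y  | yes y∈B = q⊆p∪q W D (x∈p∩q⁺ (x∈p∩q⁺ (y∈Y′ , y∈B) , x∉p⇒x∈∁p y∉Y))
    ... | inj₂ y∈Y′ | no  _    | no  y∉B = p⊆p∪q D (q⊆p∪q Y _ (x∈p∩q⁺ (y∈Y′ , x∉p⇒x∈∁p y∉B)))

    Y∩Y′∩∁B⊆ : (Y ∩ Y′) ∩ ∁ B ⊆ Y ∩ (Y′ ∩ ∁ B)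
    Y∩Y′∩∁B⊆ = ⊆-reflexive (∩-assoc Y Y′ (∁ B))

    ∣D∣+∣Y∩Y′∩B∣≤ : ∣ D ∣ + ∣ (Y ∩ Y′) ∩ B ∣ ≤ ∣ Y′ ∩ B ∣
    ∣D∣+∣Y∩Y′∩B∣≤ = begin
      ∣ D ∣ + ∣ (Y ∩ Y′) ∩ B ∣ ≤⟨ +-monoʳ-≤ ∣ D ∣ (p⊆q⇒∣p∣≤∣q∣ Y∩Y′∩B⊆) ⟩
      ∣ D ∣ + ∣ (Y′ ∩ B) ∩ Y ∣ ≡⟨ +-comm ∣ D ∣ _ ⟩
      ∣ (Y′ ∩ B) ∩ Y ∣ + ∣ D ∣ ≡⟨ ∣p∩q∣+∣p∩∁q∣≡∣p∣ (Y′ ∩ B) Y ⟩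
      ∣ Y′ ∩ B ∣               ∎
      where
      Y∩Y′∩B⊆ : (Y ∩ Y′) ∩ B ⊆ (Y′ ∩ B) ∩ Y
      Y∩Y′∩B⊆ y∈ with x∈p∩q⁻ (Y ∩ Y′) B y∈
      ... | y∈Y∩Y′ , y∈B = let y∈Y , y∈Y′ = x∈p∩q⁻ Y Y′ y∈Y∩Y′ in x∈p∩q⁺ (x∈p∩q⁺ (y∈Y′ , y∈B) , y∈Y)

  spanA-freeB-mixed : ∀ X X′ Y Y′ → spanA (X ∪ X′) (Y ∪ Y′) + freeB (X ∩ X′) (Y ∩ Y′)
                                  ≤ spanA X Y + freeB X′ Y′
  spanA-freeB-mixed X X′ Y Y′ = begin
    (RM.ρ ((X ∪ X′) ∪ A) + RN.ρ (Y ∪ Y′)) + (RM.ρ (X ∩ X′) + ρN-free (Y ∩ Y′))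
      ≡⟨ interchange (RM.ρ ((X ∪ X′) ∪ A)) _ _ _ ⟩
    (RM.ρ ((X ∪ X′) ∪ A) + RM.ρ (X ∩ X′)) + (RN.ρ (Y ∪ Y′) + ρN-free (Y ∩ Y′))
      ≤⟨ +-mono-≤ (submodular-⊆ RM.ρ (r-submod M) RM.mono X∪X′∪A⊆ X∩X′⊆) (ρN-mixed Y Y′) ⟩
    (RM.ρ (X ∪ A) + RM.ρ X′) + (RN.ρ Y + ρN-free Y′)
      ≡⟨ interchange (RM.ρ (X ∪ A)) _ _ _ ⟩
    (RM.ρ (X ∪ A) + RN.ρ Y) + (RM.ρ X′ + ρN-free Y′) ∎
    where
    open ≤-Reasoning
    X∪X′∪A⊆ : (X ∪ X′) ∪ A ⊆ (X ∪ A) ∪ X′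
    X∪X′∪A⊆ = ∪-⊆ (∪-mono (p⊆p∪q A) ⊆-refl) (p⊆p∪q X′ ∘ q⊆p∪q X A)
    X∩X′⊆ : X ∩ X′ ⊆ (X ∪ A) ∩ X′
    X∩X′⊆ = ∩-mono (p⊆p∪q A) ⊆-refl

  σ-submodular : Submodular₂ σ
  σ-submodular =
    ⊓-submodular {φ = spanA} {ψ = freeB} spanA-submodular freeB-submodular spanA-freeB-mixed

  sumMatroid : Matroid (s + t)
  sumMatroid = record
    { r        = on++ σ
    ; r-bound  = λ Z → ≤-trans (σ≤freeB _ _) (≤-trans (freeB-bound _ _) (≤-reflexive (∣split∣ Z)))
    ; r-mono   = λ _ _ → on++-monotone {φ = σ} σ-monotone
    ; r-submod = on++-submodular {φ = σ} σ-submodular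
    }
    where
    ∣split∣ : ∀ Z → ∣ take s Z ∣ + ∣ drop s Z ∣ ≡ ∣ Z ∣
    ∣split∣ Z = trans (sym (∣++∣ (take s Z) (drop s Z))) (cong ∣_∣ (sym (split-++ s Z)))

  σ-ind⇔ : ∀ X Y → IndR (on++ σ) (X ++ Y)
         ⇔ (RM.Ind X × RN.Ind (Y ∩ ∁ B) × ∣ X ∣ + ∣ Y ∣ ≤ spanA X Y)
  σ-ind⇔ X Y = mk⇔ to from
    where
    to : IndR (on++ σ) (X ++ Y) → RM.Ind X × RN.Ind (Y ∩ ∁ B) × ∣ X ∣ + ∣ Y ∣ ≤ spanA X Y
    to ind = let X-ind , Y∖B-ind = squeeze (r-bound M X) (r-bound N (Y ∩ ∁ B)) ∣X∣+∣Y∖B∣≤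
             in X-ind , Y∖B-ind , subst (_≤ spanA X Y) σ≡ (σ≤spanA X Y)
      where
      σ≡ : σ X Y ≡ ∣ X ∣ + ∣ Y ∣
      σ≡ = Equivalence.to (on++-ind⇔ σ X Y) ind
      ∣X∣+∣Y∖B∣≤ : ∣ X ∣ + ∣ Y ∩ ∁ B ∣ ≤ RM.ρ X + RN.ρ (Y ∩ ∁ B)
      ∣X∣+∣Y∖B∣≤ = +-cancelʳ-≤ ∣ Y ∩ B ∣ _ _ (begin
        ∣ X ∣ + ∣ Y ∩ ∁ B ∣ + ∣ Y ∩ B ∣        ≡⟨ +-assoc ∣ X ∣ _ _ ⟩
        ∣ X ∣ + (∣ Y ∩ ∁ B ∣ + ∣ Y ∩ B ∣)      ≡⟨ cong (∣ X ∣ +_) (∣Y∣-along-B Y) ⟩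
        ∣ X ∣ + ∣ Y ∣                          ≡⟨ sym σ≡ ⟩
        σ X Y                                  ≤⟨ σ≤freeB X Y ⟩
        RM.ρ X + (RN.ρ (Y ∩ ∁ B) + ∣ Y ∩ B ∣)  ≡⟨ sym (+-assoc (RM.ρ X) _ _) ⟩
        RM.ρ X + RN.ρ (Y ∩ ∁ B) + ∣ Y ∩ B ∣    ∎)
        where open ≤-Reasoning

    from : RM.Ind X × RN.Ind (Y ∩ ∁ B) × ∣ X ∣ + ∣ Y ∣ ≤ spanA X Y → IndR (on++ σ) (X ++ Y)
    from (X-ind , Y∖B-ind , ≤spanA) = Equivalence.from (on++-ind⇔ σ X Y)
      (≤-antisym (≤-trans (σ≤freeB X Y) (≤-reflexive freeB≡))
                 (⊓-glb ≤spanA (≤-reflexive (sym freeB≡))))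
      where
      freeB≡ : freeB X Y ≡ ∣ X ∣ + ∣ Y ∣
      freeB≡ = cong₂ _+_ X-ind (trans (cong (_+ ∣ Y ∩ B ∣) Y∖B-ind) (∣Y∣-along-B Y))

  plus-ind⇔ : ∀ X Y → IndR (plusRank M A B) (X ++ Y)
            ⇔ (RM.Ind X × Y ⊆ B × ∣ X ∣ + ∣ Y ∣ ≤ RM.ρ (X ∪ A))
  plus-ind⇔ X Y = mk⇔ to from
    where
    plusφ : Subset s → Subset t → ℕ
    plusφ X Y = RM.ρ (X ∪ A) ⊓ (RM.ρ X + ∣ Y ∩ B ∣)

    to : IndR (plusRank M A B) (X ++ Y) → RM.Ind X × Y ⊆ B × ∣ X ∣ + ∣ Y ∣ ≤ RM.ρ (X ∪ A)
    to ind = let X-ind , ∣Y∩B∣≡∣Y∣ = squeeze (r-bound M X) (∣p∩q∣≤∣p∣ Y B)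
                                        (subst (_≤ _) ≡∣X∣+∣Y∣ (m⊓n≤n _ _))
             in X-ind , ∣p∩q∣≡∣p∣⇒p⊆q Y B ∣Y∩B∣≡∣Y∣ , subst (_≤ _) ≡∣X∣+∣Y∣ (m⊓n≤m _ _)
      where
      ≡∣X∣+∣Y∣ : plusφ X Y ≡ ∣ X ∣ + ∣ Y ∣
      ≡∣X∣+∣Y∣ = Equivalence.to (on++-ind⇔ plusφ X Y) ind

    from : RM.Ind X × Y ⊆ B × ∣ X ∣ + ∣ Y ∣ ≤ RM.ρ (X ∪ A) → IndR (plusRank M A B) (X ++ Y)
    from (X-ind , Y⊆B , ≤ρX∪A) = Equivalence.from (on++-ind⇔ plusφ X Y)
      (trans (cong (RM.ρ (X ∪ A) ⊓_) free≡) (m≥n⇒m⊓n≡n ≤ρX∪A))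
      where
      free≡ : RM.ρ X + ∣ Y ∩ B ∣ ≡ ∣ X ∣ + ∣ Y ∣
      free≡ = cong₂ _+_ X-ind (cong ∣_∣ (⊆-antisym (p∩q⊆p Y B) (λ y∈Y → x∈p∩q⁺ (y∈Y , Y⊆B y∈Y))))

  loop-ind⇔ : ∀ X Y → IndR (loopRank {s} N) (X ++ Y) ⇔ (X ≡ ⊥ × RN.Ind Y)
  loop-ind⇔ X Y = mk⇔ to from
    where
    loopφ : Subset s → Subset t → ℕ
    loopφ _ Y = RN.ρ Y

    to : IndR (loopRank {s} N) (X ++ Y) → X ≡ ⊥ × RN.Ind Y
    to ind = Empty-unique (λ (x , x∈X) → ∣p∣≡0⇒x∉p X ∣X∣≡0 x∈X)
           , trans ≡∣X∣+∣Y∣ (cong (_+ ∣ Y ∣) ∣X∣≡0)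
      where
      ≡∣X∣+∣Y∣ : RN.ρ Y ≡ ∣ X ∣ + ∣ Y ∣
      ≡∣X∣+∣Y∣ = Equivalence.to (on++-ind⇔ loopφ X Y) ind
      ∣X∣≡0 : ∣ X ∣ ≡ 0
      ∣X∣≡0 = n≤0⇒n≡0 (+-cancelʳ-≤ ∣ Y ∣ ∣ X ∣ 0 (subst (_≤ ∣ Y ∣) ≡∣X∣+∣Y∣ (r-bound N Y)))

    from : X ≡ ⊥ × RN.Ind Y → IndR (loopRank {s} N) (X ++ Y)
    from (refl , Y-ind) = Equivalence.from (on++-ind⇔ loopφ ⊥ Y)
      (trans Y-ind (cong (_+ ∣ Y ∣) (sym (∣⊥∣≡0 s))))

  -- A union of an M⁺(A,B)-independent X₁ ++ Y₁ and an N₀-independent ⊥ ++ Y₂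
  -- is σ-independent: Y₁ ⊆ B, so (Y₁ ∪ Y₂) ∖ B ⊆ Y₂.
  plus∪loop⇒ind : ∀ X₁ Y₁ Y₂ → IndR (plusRank M A B) (X₁ ++ Y₁) → RN.Ind Y₂
                → IndR (on++ σ) ((X₁ ++ Y₁) ∪ (⊥ ++ Y₂))
  plus∪loop⇒ind X₁ Y₁ Y₂ J₁-ind Y₂-ind with Equivalence.to (plus-ind⇔ X₁ Y₁) J₁-ind
  ... | X₁-ind , Y₁⊆B , ∣X₁∣+∣Y₁∣≤ =
    subst (IndR (on++ σ)) (sym (trans (++-∪ X₁ ⊥ Y₁ Y₂) (cong (_++ (Y₁ ∪ Y₂)) (∪-identityʳ X₁))))
      (Equivalence.from (σ-ind⇔ X₁ (Y₁ ∪ Y₂)) (X₁-ind , RN.hereditary Y₂-ind Y∖B⊆Y₂ , ≤spanA))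
    where
    Y∖B⊆Y₂ : (Y₁ ∪ Y₂) ∩ ∁ B ⊆ Y₂
    Y∖B⊆Y₂ y∈ with x∈p∩q⁻ (Y₁ ∪ Y₂) (∁ B) y∈
    ... | y∈Y₁∪Y₂ , y∉B =
      [ (λ y∈Y₁ → ⊥-elim (x∈∁p⇒x∉p y∉B (Y₁⊆B y∈Y₁))) , id ]′ (x∈p∪q⁻ Y₁ Y₂ y∈Y₁∪Y₂)

    ≤spanA : ∣ X₁ ∣ + ∣ Y₁ ∪ Y₂ ∣ ≤ spanA X₁ (Y₁ ∪ Y₂)
    ≤spanA = begin
      ∣ X₁ ∣ + ∣ Y₁ ∪ Y₂ ∣        ≤⟨ +-monoʳ-≤ ∣ X₁ ∣ (∣p∪q∣≤∣p∣+∣q∣ Y₁ Y₂) ⟩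
      ∣ X₁ ∣ + (∣ Y₁ ∣ + ∣ Y₂ ∣)  ≡⟨ sym (+-assoc ∣ X₁ ∣ _ _) ⟩
      ∣ X₁ ∣ + ∣ Y₁ ∣ + ∣ Y₂ ∣    ≤⟨ +-mono-≤ ∣X₁∣+∣Y₁∣≤ (≤-reflexive (sym Y₂-ind)) ⟩
      RM.ρ (X₁ ∪ A) + RN.ρ Y₂     ≤⟨ +-monoʳ-≤ _ (RN.mono (q⊆p∪q Y₁ Y₂)) ⟩
      spanA X₁ (Y₁ ∪ Y₂)          ∎
      where open ≤-Reasoning

  -- Conversely, a σ-independent X ++ Y splits as X ++ (Y ∖ Y₂) ∪ ⊥ ++ Y₂,
  -- where Y₂ is a basis of Y (in N) containing Y ∖ B.
  ind⇒plus∪loop : ∀ X Y → IndR (on++ σ) (X ++ Y) → PrincipalSumInd M N A B (X ++ Y)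
  ind⇒plus∪loop X Y ind with Equivalence.to (σ-ind⇔ X Y) ind
  ... | X-ind , Y∖B-ind , ∣X∣+∣Y∣≤ with RN.extend-to-basis (p∩q⊆p Y (∁ B)) Y∖B-ind
  ... | Y₂ , Y∖B⊆Y₂ , Y₂⊆Y , Y₂-ind , ∣Y₂∣≡ρY =
    X ++ Y₁ , ⊥ ++ Y₂ , X++Y≡ ,
    Equivalence.from (plus-ind⇔ X Y₁) (X-ind , Y₁⊆B , ∣X∣+∣Y₁∣≤) ,
    Equivalence.from (loop-ind⇔ ⊥ Y₂) (refl , Y₂-ind)
    where
    Y₁ = Y ∩ ∁ Y₂

    Y₁⊆B : Y₁ ⊆ B
    Y₁⊆B {y} y∈Y₁ = let y∈Y , y∉Y₂ = x∈p∩q⁻ Y (∁ Y₂) y∈Y₁ in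
      decidable-stable (y ∈? B) λ y∉B → x∈∁p⇒x∉p y∉Y₂ (Y∖B⊆Y₂ (x∈p∩q⁺ (y∈Y , x∉p⇒x∈∁p y∉B)))

    Y₁∪Y₂≡Y : Y₁ ∪ Y₂ ≡ Y
    Y₁∪Y₂≡Y = ⊆-antisym (∪-⊆ (p∩q⊆p Y (∁ Y₂)) Y₂⊆Y) Y⊆
      where
      Y⊆ : Y ⊆ Y₁ ∪ Y₂
      Y⊆ {y} y∈Y with y ∈? Y₂
      ... | yes y∈Y₂ = q⊆p∪q Y₁ Y₂ y∈Y₂
      ... | no  y∉Y₂ = p⊆p∪q Y₂ (x∈p∩q⁺ (y∈Y , x∉p⇒x∈∁p y∉Y₂))

    X++Y≡ : X ++ Y ≡ (X ++ Y₁) ∪ (⊥ ++ Y₂)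
    X++Y≡ = sym (trans (++-∪ X ⊥ Y₁ Y₂) (cong₂ _++_ (∪-identityʳ X) Y₁∪Y₂≡Y))

    ∣Y∣≡ : ∣ Y ∣ ≡ ∣ Y₁ ∣ + ∣ Y₂ ∣
    ∣Y∣≡ = begin
      ∣ Y ∣                      ≡⟨ sym (∣p∩q∣+∣p∩∁q∣≡∣p∣ Y Y₂) ⟩
      ∣ Y ∩ Y₂ ∣ + ∣ Y₁ ∣        ≡⟨ cong (λ P → ∣ P ∣ + ∣ Y₁ ∣) Y∩Y₂≡Y₂ ⟩
      ∣ Y₂ ∣ + ∣ Y₁ ∣            ≡⟨ +-comm ∣ Y₂ ∣ _ ⟩
      ∣ Y₁ ∣ + ∣ Y₂ ∣            ∎
      where
      open ≡-Reasoning
      Y∩Y₂≡Y₂ : Y ∩ Y₂ ≡ Y₂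
      Y∩Y₂≡Y₂ = ⊆-antisym (p∩q⊆q Y Y₂) (λ y∈Y₂ → x∈p∩q⁺ (Y₂⊆Y y∈Y₂ , y∈Y₂))

    ∣X∣+∣Y₁∣≤ : ∣ X ∣ + ∣ Y₁ ∣ ≤ RM.ρ (X ∪ A)
    ∣X∣+∣Y₁∣≤ = +-cancelʳ-≤ ∣ Y₂ ∣ _ _ (begin
      ∣ X ∣ + ∣ Y₁ ∣ + ∣ Y₂ ∣    ≡⟨ trans (+-assoc ∣ X ∣ _ _) (cong (∣ X ∣ +_) (sym ∣Y∣≡)) ⟩
      ∣ X ∣ + ∣ Y ∣              ≤⟨ ∣X∣+∣Y∣≤ ⟩
      RM.ρ (X ∪ A) + RN.ρ Y      ≡⟨ cong (RM.ρ (X ∪ A) +_) (sym ∣Y₂∣≡ρY) ⟩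
      RM.ρ (X ∪ A) + ∣ Y₂ ∣      ∎)
      where open ≤-Reasoning

  loop-ind⇒ : ∀ J → IndR (loopRank {s} N) J → J ≡ ⊥ ++ drop s J × RN.Ind (drop s J)
  loop-ind⇒ J J-ind
    with Equivalence.to (loop-ind⇔ (take s J) (drop s J))
                        (subst (IndR (loopRank N)) (split-++ s J) J-ind)
  ... | take≡⊥ , drop-ind = trans (split-++ s J) (cong (_++ drop s J) take≡⊥) , drop-ind

  ind⇔ : ∀ Z → PrincipalSumInd M N A B Z ⇔ IndR (on++ σ) Z
  ind⇔ Z = mk⇔ union⇒ind (by-split (λ Z → IndR (on++ σ) Z → PrincipalSumInd M N A B Z)
                                   ind⇒plus∪loop Z)
    where
    union⇒ind : PrincipalSumInd M N A B Z → IndR (on++ σ) Z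
    union⇒ind (J₁ , J₂ , refl , J₁-ind , J₂-ind) =
      let J₂≡ , Y₂-ind = loop-ind⇒ J₂ J₂-ind in
      subst (IndR (on++ σ)) (cong₂ _∪_ (sym (split-++ s J₁)) (sym J₂≡))
        (plus∪loop⇒ind (take s J₁) (drop s J₁) (drop s J₂)
                       (subst (IndR (plusRank M A B)) (split-++ s J₁) J₁-ind) Y₂-ind)

  Compatible : Subset s → Subset t → Set
  Compatible X Y = A ⊆ X ⊎ Y ∩ B ≡ ⊥

  compatible-mono : ∀ {X X′ Y Y′} → X ⊆ X′ → Y′ ⊆ Y → Compatible X Y → Compatible X′ Y′
  compatible-mono X⊆X′ Y′⊆Y (inj₁ A⊆X)    = inj₁ (X⊆X′ ∘ A⊆X)
  compatible-mono X⊆X′ Y′⊆Y (inj₂ Y∩B≡⊥) =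
    inj₂ (Empty-unique λ (y , y∈) → ∉⊥ (subst (y ∈_) Y∩B≡⊥ (∩-mono Y′⊆Y ⊆-refl y∈)))

  compatible-delete : ∀ {X Y} → Compatible X Y → ∀ x → Compatible (X - x) Y ⊎ (x ∈ A × A ⊆ X)
  compatible-delete (inj₂ Y∩B≡⊥) x = inj₁ (inj₂ Y∩B≡⊥)
  compatible-delete (inj₁ A⊆X)   x with x ∈? A
  ... | yes x∈A = inj₂ (x∈A , A⊆X)
  ... | no  x∉A = inj₁ (inj₁ λ a∈A → x∈p∧x≢y⇒x∈p-y (A⊆X a∈A) λ { refl → x∉A a∈A })

  compatible-add : ∀ {X Y} → Compatible X Y → ∀ y → Compatible X (Y ∪ ⁅ y ⁆) ⊎ (Y ⊆ ∁ B × y ∈ B)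
  compatible-add (inj₁ A⊆X)   y = inj₁ (inj₁ A⊆X)
  compatible-add {Y = Y} (inj₂ Y∩B≡⊥) y with y ∈? B
  ... | yes y∈B = inj₂ (p∩q≡⊥⇒p⊆∁q Y∩B≡⊥ , y∈B)
  ... | no  y∉B = inj₁ (inj₂ (Empty-unique λ (z , z∈) →
    let z∈Y∪y , z∈B = x∈p∩q⁻ (Y ∪ ⁅ y ⁆) B z∈ in
    [ (λ z∈Y → x∈∁p⇒x∉p (p∩q≡⊥⇒p⊆∁q Y∩B≡⊥ z∈Y) z∈B)
    , (λ z∈⁅y⁆ → y∉B (subst (_∈ B) (x∈⁅y⁆⇒x≡y y z∈⁅y⁆) z∈B)) ]′ (x∈p∪q⁻ Y ⁅ y ⁆ z∈Y∪y)))

  sum≤σ : ∀ X Y → RM.ρ X + RN.ρ Y ≤ σ X Y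
  sum≤σ X Y = ⊓-glb (+-monoˡ-≤ (RN.ρ Y) (RM.mono (p⊆p∪q A)))
                    (+-monoʳ-≤ (RM.ρ X) (≤-trans (RN.mono Y⊆) (RN.∪-bound (Y ∩ ∁ B) (Y ∩ B))))
    where
    Y⊆ : Y ⊆ (Y ∩ ∁ B) ∪ (Y ∩ B)
    Y⊆ {y} y∈Y with y ∈? B
    ... | yes y∈B = q⊆p∪q _ _ (x∈p∩q⁺ (y∈Y , y∈B))
    ... | no  y∉B = p⊆p∪q _ (x∈p∩q⁺ (y∈Y , x∉p⇒x∈∁p y∉B))

  σ≡sum : ∀ {X Y} → Compatible X Y → σ X Y ≡ RM.ρ X + RN.ρ Y
  σ≡sum {X} {Y} (inj₁ A⊆X) = ≤-antisym
    (≤-trans (σ≤spanA X Y) (+-monoˡ-≤ (RN.ρ Y) (RM.mono (∪-⊆ ⊆-refl A⊆X))))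
    (sum≤σ X Y)
  σ≡sum {X} {Y} (inj₂ Y∩B≡⊥) = ≤-antisym
    (≤-trans (σ≤freeB X Y) (+-monoʳ-≤ (RM.ρ X) ρN-free≤))
    (sum≤σ X Y)
    where
    ρN-free≤ : RN.ρ (Y ∩ ∁ B) + ∣ Y ∩ B ∣ ≤ RN.ρ Y
    ρN-free≤ = begin
      RN.ρ (Y ∩ ∁ B) + ∣ Y ∩ B ∣ ≡⟨ cong (RN.ρ (Y ∩ ∁ B) +_) (trans (cong ∣_∣ Y∩B≡⊥) (∣⊥∣≡0 t)) ⟩
      RN.ρ (Y ∩ ∁ B) + 0         ≡⟨ +-identityʳ _ ⟩
      RN.ρ (Y ∩ ∁ B)             ≤⟨ RN.mono (p∩q⊆p Y (∁ B)) ⟩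
      RN.ρ Y                     ∎
      where open ≤-Reasoning

  σ-CyclicFlat : Subset s → Subset t → Set
  σ-CyclicFlat X Y = RankCyclicFlat (λ X′ → σ X′ Y) X × RankCyclicFlat (σ X) Y

  -- Compatible pairs of cyclic flats of M and N are cyclic flats of σ: at a
  -- compatible pair σ is the rank of M ⊕ N, and everywhere else it is larger.
  compatible⇒σ-cyclicFlat : ∀ {X Y} → RankCyclicFlat RM.ρ X → RankCyclicFlat RN.ρ Y
                          → Compatible X Y → σ-CyclicFlat X Y
  compatible⇒σ-cyclicFlat {X} {Y} (cyclicˣ , flatˣ) (cyclicʸ , flatʸ) compatible =
    ( (λ x x∈X → keep (p─q⊆p X ⁅ x ⁆) ⊆-refl (cong (_+ RN.ρ Y) (cyclicˣ x x∈X)))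
    , (λ x x∉X → raise (+-monoˡ-< (RN.ρ Y) (change⇒increase RM.mono (flatˣ x x∉X)))) )
    , ( (λ y y∈Y → keep ⊆-refl (p─q⊆p Y ⁅ y ⁆) (cong (RM.ρ X +_) (cyclicʸ y y∈Y)))
      , (λ y y∉Y → raise (+-monoʳ-< (RM.ρ X) (change⇒increase RN.mono (flatʸ y y∉Y)))) )
    where
    keep : ∀ {X′ Y′} → X′ ⊆ X → Y′ ⊆ Y → RM.ρ X′ + RN.ρ Y′ ≡ RM.ρ X + RN.ρ Y → σ X′ Y′ ≡ σ X Y
    keep X′⊆X Y′⊆Y same = ≤-antisym (σ-monotone X′⊆X Y′⊆Y)
      (≤-trans (≤-reflexive (trans (σ≡sum compatible) (sym same))) (sum≤σ _ _))

    raise : ∀ {X′ Y′} → RM.ρ X + RN.ρ Y < RM.ρ X′ + RN.ρ Y′ → σ X′ Y′ ≢ σ X Y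
    raise {X′} {Y′} larger σ′≡σ = <-irrefl refl (begin-strict
      σ X Y                ≡⟨ σ≡sum compatible ⟩
      RM.ρ X + RN.ρ Y      <⟨ larger ⟩
      RM.ρ X′ + RN.ρ Y′    ≤⟨ sum≤σ X′ Y′ ⟩
      σ X′ Y′              ≡⟨ σ′≡σ ⟩
      σ X Y                ∎)
      where open ≤-Reasoning


  freeB-delete : ∀ X {Y y} → y ∈ Y ∩ B → freeB X (Y - y) < freeB X Y
  freeB-delete X {Y} {y} y∈Y∩B = +-monoʳ-< (RM.ρ X)
    (+-mono-≤-< (RN.mono (∩-mono (p─q⊆p Y ⁅ y ⁆) ⊆-refl))
                (≤-<-trans (p⊆q⇒∣p∣≤∣q∣ Y-y∩B⊆) (x∈p⇒∣p-x∣<∣p∣ y∈Y∩B)))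
    where
    Y-y∩B⊆ : (Y - y) ∩ B ⊆ (Y ∩ B) - y
    Y-y∩B⊆ z∈ = let z∈Y-y , z∈B = x∈p∩q⁻ (Y - y) B z∈ ; z∈Y , z≢y = x∈p-y⁻ z∈Y-y in
      x∈p∧x≢y⇒x∈p-y (x∈p∩q⁺ (z∈Y , z∈B)) z≢y

  -- If a ∈ A lies outside X, then
  -- σ X Y ≠ spanA X Y, since adding a does not change spanA; so σ X Y = freeB X Y,
  -- and cyclicity forbids elements of Y ∩ B, whose deletion lowers freeB.
  σ-cyclicFlat⇒compatible : ∀ {X Y} → σ-CyclicFlat X Y → Compatible X Y
  σ-cyclicFlat⇒compatible {X} {Y} ((_ , flatˣ) , (cyclicʸ , _)) with A ⊆? X
  ... | yes A⊆X = inj₁ A⊆X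
  ... | no  A⊈X with ⊈⇒∃∉ A⊈X | ⊓-sel (spanA X Y) (freeB X Y)
  ...   | a , a∈A , a∉X | inj₁ σ≡spanA = ⊥-elim (flatˣ a a∉X (≤-antisym (begin
    σ (X ∪ ⁅ a ⁆) Y     ≤⟨ σ≤spanA (X ∪ ⁅ a ⁆) Y ⟩
    spanA (X ∪ ⁅ a ⁆) Y ≤⟨ +-monoˡ-≤ (RN.ρ Y) (RM.mono X∪a∪A⊆) ⟩
    spanA X Y           ≡⟨ sym σ≡spanA ⟩
    σ X Y               ∎) (σ-monotone (p⊆p∪q ⁅ a ⁆) ⊆-refl)))
    where
    open ≤-Reasoning
    X∪a∪A⊆ : (X ∪ ⁅ a ⁆) ∪ A ⊆ X ∪ A
    X∪a∪A⊆ = ∪-⊆ (∪-mono ⊆-refl (⁅x⁆⊆p a∈A)) (q⊆p∪q X A)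

  ...   | _ | inj₂ σ≡freeB = inj₂ (Empty-unique λ (y , y∈Y∩B) → <-irrefl refl (begin-strict
    σ X Y           ≡⟨ sym (cyclicʸ y (p∩q⊆p Y B y∈Y∩B)) ⟩
    σ X (Y - y)     ≤⟨ σ≤freeB X (Y - y) ⟩
    freeB X (Y - y) <⟨ freeB-delete X y∈Y∩B ⟩
    freeB X Y       ≡⟨ sym σ≡freeB ⟩
    σ X Y           ∎))
    where open ≤-Reasoning

  -- Each
  -- neighbour of a compatible pair is compatible, where σ is the rank of
  -- M ⊕ N, except in two cases handled by the hypotheses on A and B: deleting
  -- x ∈ A ⊆ X (A is cyclic, so A - x spans x), and adding y ∈ B to Y ⊆ ∁ B
  -- (∁ B is a flat of N).
  σ-cyclicFlat⇒components : RankCyclic RM.ρ A → RankFlat RN.ρ (∁ B)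
                          → ∀ {X Y} → σ-CyclicFlat X Y → Compatible X Y
                          → RankCyclicFlat RM.ρ X × RankCyclicFlat RN.ρ Y
  σ-cyclicFlat⇒components A-cyclic ∁B-flat {X} {Y}
                          ((cyclicˣ , flatˣ) , (cyclicʸ , flatʸ)) compatible =
    (deleteˣ , addˣ) , (deleteʸ , addʸ)
    where
    sum≡ : ∀ {X′ Y′} → Compatible X′ Y′ → σ X′ Y′ ≡ σ X Y → RM.ρ X′ + RN.ρ Y′ ≡ RM.ρ X + RN.ρ Y
    sum≡ compatible′ σ′≡σ = trans (sym (σ≡sum compatible′)) (trans σ′≡σ (σ≡sum compatible))

    deleteˣ : RankCyclic RM.ρ X
    deleteˣ x x∈X with compatible-delete compatible x
    ... | inj₁ compatible′ = +-cancelʳ-≡ (RN.ρ Y) _ _ (sum≡ compatible′ (cyclicˣ x x∈X))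
    ... | inj₂ (x∈A , A⊆X) =
      RM.spans⇒redundant x∈X (p⊆q⇒p-x⊆q-x A⊆X) (RM.redundant⇒spans x∈A (A-cyclic x x∈A))

    addˣ : RankFlat RM.ρ X
    addˣ x x∉X ρ≡ = flatˣ x x∉X (trans (σ≡sum (compatible-mono (p⊆p∪q ⁅ x ⁆) ⊆-refl compatible))
                                       (trans (cong (_+ RN.ρ Y) ρ≡) (sym (σ≡sum compatible))))

    deleteʸ : RankCyclic RN.ρ Y
    deleteʸ y y∈Y = +-cancelˡ-≡ (RM.ρ X) _ _
      (sum≡ (compatible-mono ⊆-refl (p─q⊆p Y ⁅ y ⁆) compatible) (cyclicʸ y y∈Y))

    addʸ : RankFlat RN.ρ Y
    addʸ y y∉Y ρ≡ with compatible-add compatible y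
    ... | inj₁ compatible′ = flatʸ y y∉Y (trans (σ≡sum compatible′)
                               (trans (cong (RM.ρ X +_) ρ≡) (sym (σ≡sum compatible))))
    ... | inj₂ (Y⊆∁B , y∈B) = ∁B-flat y (x∈p⇒x∉∁p y∈B) (RN.spans-⊆ ⁅ y ⁆ Y⊆∁B ρ≡)

  σ-cyclicFlat⇔ : RankCyclic RM.ρ A → RankFlat RN.ρ (∁ B) → ∀ X Y
                → σ-CyclicFlat X Y
                  ⇔ (RankCyclicFlat RM.ρ X × RankCyclicFlat RN.ρ Y × Compatible X Y)
  σ-cyclicFlat⇔ A-cyclic ∁B-flat X Y = mk⇔
    (λ σ-cf → let compatible = σ-cyclicFlat⇒compatible σ-cf
                  cfˣ , cfʸ = σ-cyclicFlat⇒components A-cyclic ∁B-flat σ-cf compatible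
              in cfˣ , cfʸ , compatible)
    (λ (cfˣ , cfʸ , compatible) → compatible⇒σ-cyclicFlat cfˣ cfʸ compatible)

  cyclicFlat-++⇔ : RankCyclic RM.ρ A → RankFlat RN.ρ (∁ B) → ∀ X Y
                 → CyclicFlat (PrincipalSumInd M N A B) (X ++ Y)
                 ⇔ (CyclicFlat RM.Ind X × CyclicFlat RN.Ind Y × Compatible X Y)
  cyclicFlat-++⇔ A-cyclic ∁B-flat X Y = begin
    CyclicFlat (PrincipalSumInd M N A B) (X ++ Y)
      ≈⟨ cyclicFlat-resp-⇔ ind⇔ (X ++ Y) ⟩
    CyclicFlat (IndR (on++ σ)) (X ++ Y)
      ≈⟨ Rank.cyclicFlat⇔ sumMatroid (X ++ Y) ⟩
    RankCyclicFlat (on++ σ) (X ++ Y)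
      ≈⟨ rankCyclicFlat-++⇔ σ X Y ⟩
    σ-CyclicFlat X Y
      ≈⟨ σ-cyclicFlat⇔ A-cyclic ∁B-flat X Y ⟩
    (RankCyclicFlat RM.ρ X × RankCyclicFlat RN.ρ Y × Compatible X Y)
      ≈⟨ ⇔-sym (RM.cyclicFlat⇔ X ×-⇔ RN.cyclicFlat⇔ Y ×-⇔ ⇔-id _) ⟩
    (CyclicFlat RM.Ind X × CyclicFlat RN.Ind Y × Compatible X Y) ∎
    where open SetoidReasoning (⇔-setoid 0ℓ)

corollary3p14 : ∀ (s t : ℕ) (M : Matroid s) (N : Matroid t) (A : Subset s) (B : Subset t)
    → CyclicFlat (IndR (r M)) A
    → CyclicFlat (IndR (dualRank N)) B
    → ∀ (Z : Subset (s + t))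
    → CyclicFlat (PrincipalSumInd M N A B) Z
      ⇔ (∃[ ZM ] ∃[ ZN ] (Z ≡ ZM ++ ZN × CyclicFlat (IndR (r M)) ZM × CyclicFlat (IndR (r N)) ZN
           × (A ⊆ ZM ⊎ ZN ∩ B ≡ ⊥)))
corollary3p14 s t M N A B (A-cyclic , _) (B-dual-cyclic , _) Z = mk⇔
  (λ Z-cf → take s Z , drop s Z , split-++ s Z ,
     Equivalence.to (characterisation (take s Z) (drop s Z))
                    (subst (CyclicFlat _) (split-++ s Z) Z-cf))
  (λ (ZM , ZN , Z≡ , parts) →
     subst (CyclicFlat _) (sym Z≡) (Equivalence.from (characterisation ZM ZN) parts))
  where
  open PrincipalSum M N A B

  characterisation : ∀ X Y → CyclicFlat (PrincipalSumInd M N A B) (X ++ Y)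
                           ⇔ (CyclicFlat RM.Ind X × CyclicFlat RN.Ind Y × Compatible X Y)
  characterisation = cyclicFlat-++⇔ (Equivalence.to (RM.cyclic⇔ A) A-cyclic)
                                    (RN.dual-cyclic⇒∁flat B-dual-cyclic)
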